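{- Let $n \geq 1$ and let $\ell \in \mathcal{L}_n$ be the line $y = \alpha x + \rho$ (so $\alpha, \rho \in [0,1]$). Then \[ |m(\ell)| = \begin{cases} 0 & \text{if } \alpha = \rho = 1,\\ 1 & \text{if } \alpha = \rho = 0,\\ \mathbb{Z}_n(\ell) - 1 & \text{if } \alpha, \rho \in (0,1),\\ \mathbb{Z}_n(\ell) - \mathbb{Z}_{n/2}(\ell) & \text{if } \rho = 0 \text{ and } \alpha \in (0,1],\\ \mathbb{Z}_{n/2}(\ell) - 1 & \text{if } \rho = 1 \text{ and } \alpha \in [0,1).\end{cases} \]
   Context: An infinite binary word over $\{0,1\}$ is Sturmian if it has exactly $k+1$ distinct factors of length $k$ for every $k \geq 0$; a finite Sturmian word is a factor of some infinite Sturmian word. Let $A_n$ be the set of finite Sturmian words of length $n$. A line $y = \alpha x + \rho$ with $\alpha, \rho \in (0,1)$ defines the word $a_0 \cdots a_{n-1}$ with $a_k = \lfloor (k+1)\alpha + \rho \rfloor - \lfloor k\alpha + \rho \rfloor$. Let $\mathcal{S}_n$ be the set of lines $y = \alpha x + \rho$ with $\alpha, \rho \in (0,1)$, in the grid $[0,n]\times[0,n]$. For a line $\ell$ and real $k$, $\mathbb{Z}_k(\ell)$ is the number of integer points $(i,j)$ on $\ell$ with $0 \leq i \leq k$. $\mathcal{L}_n$ is the set of lines $y = \alpha x + \rho$ with $\alpha \in [0,1]$, $\rho \in [0,1]$ and $\mathbb{Z}_n(\ell) \geq 2$. The map $m \colon \mathcal{L}_n \to 2^{A_n}$ is defined by: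 $w \in m(\ell)$ iff there is $\ell' \in \mathcal{S}_n$ such that (i) $\ell'$ defines $w$; (ii) no integer grid points of $[0,n]\times[0,n]$ lie between $\ell$ and $\ell'$; (iii) $\ell'$ passes above two integer points $(i_1,j_1)$, $(i_2,j_2)$ of $\ell$ with $i_1 \leq n/2 < i_2$.
   Formalization: The parameters α, ρ of the line ℓ, and those of the lines ℓ′ ∈ 𝒮_n in the definition of m, are rational rather than real. -}

module Defs where

open import Data.Nat as ℕ using (ℕ; suc; ⌊_/2⌋)
open import Data.Integer as ℤ using (ℤ; +_)
open import Data.Rational as ℚ using (ℚ; _/_; floor; 0ℚ; 1ℚ)
open import Data.Rational.Properties using (_≟_)
open import Data.Fin using (Fin; toℕ)
open import Data.Vec using (Vec; tabulate)
open import Data.List using (List; length; filter; upTo)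
open import Data.List.Relation.Unary.Unique.Propositional using (Unique)
open import Data.List.Membership.Propositional using (_∈_)
open import Data.Product using (Σ; ∃; _×_; Σ-syntax; ∃-syntax)
open import Data.Sum using (_⊎_)
open import Relation.Binary.PropositionalEquality using (_≡_)

-- Lines y = α x + ρ are represented by their parameters (α , ρ) ∈ ℚ².

ℕ→ℚ : ℕ → ℚ
ℕ→ℚ i = + i / 1

ℤ→ℚ : ℤ → ℚ
ℤ→ℚ j = j / 1

lineAt : ℚ → ℚ → ℕ → ℚ
lineAt α ρ i = α ℚ.* ℕ→ℚ i ℚ.+ ρ

OnLine : ℚ → ℚ → ℕ → ℤ → Set
OnLine α ρ i j = lineAt α ρ i ≡ ℤ→ℚ j

-- ℤ_k(ℓ) for a natural bound k: number of integer points (i , j) on ℓ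
-- with 0 ≤ i ≤ k.  (The point with abscissa i is unique, j = α i + ρ;
-- it is an integer point iff α i + ρ is an integer, i.e. equals its floor.)
Zcount : ℕ → ℚ → ℚ → ℕ
Zcount k α ρ =
  length (filter (λ i → ℤ→ℚ (floor (lineAt α ρ i)) ≟ lineAt α ρ i) (upTo (suc k)))

Zn : ℕ → ℚ → ℚ → ℕ
Zn n α ρ = Zcount n α ρ

-- ℤ_{n/2}(ℓ): integers i with 0 ≤ i ≤ n/2 are exactly 0 ≤ i ≤ ⌊n/2⌋
Zhalf : ℕ → ℚ → ℚ → ℕ
Zhalf n α ρ = Zcount ⌊ n /2⌋ α ρ

wordOf : (n : ℕ) → ℚ → ℚ → Vec ℤ n
wordOf n α ρ = tabulate (λ (k : Fin n) →
  floor (lineAt α ρ (suc (toℕ k))) ℤ.- floor (lineAt α ρ (toℕ k)))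

InS : ℚ → ℚ → Set
InS α' ρ' = (0ℚ ℚ.< α' × α' ℚ.< 1ℚ) × (0ℚ ℚ.< ρ' × ρ' ℚ.< 1ℚ)

-- the grid point (i , j) (0 ≤ i , j ≤ n) lies between ℓ = (α,ρ) and
-- ℓ' = (α',ρ'): strictly on the far side of ℓ and on or beyond ℓ'
-- (points on ℓ' count as between, points on ℓ do not).
BetweenPt : ℚ → ℚ → ℚ → ℚ → ℕ → ℕ → Set
BetweenPt α ρ α' ρ' i j =
    (lineAt α ρ i ℚ.< ℕ→ℚ j × ℕ→ℚ j ℚ.≤ lineAt α' ρ' i)
  ⊎ (lineAt α' ρ' i ℚ.≤ ℕ→ℚ j × ℕ→ℚ j ℚ.< lineAt α ρ i)

NoGridBetween : ℕ → ℚ → ℚ → ℚ → ℚ → Set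
NoGridBetween n α ρ α' ρ' =
  ∀ i j → i ℕ.≤ n → j ℕ.≤ n → BetweenPt α ρ α' ρ' i j → Data.Empty.⊥
  where import Data.Empty

PassesAboveTwo : ℕ → ℚ → ℚ → ℚ → ℚ → Set
PassesAboveTwo n α ρ α' ρ' =
  Σ[ i₁ ∈ ℕ ] Σ[ j₁ ∈ ℤ ] Σ[ i₂ ∈ ℕ ] Σ[ j₂ ∈ ℤ ]
    (OnLine α ρ i₁ j₁ × OnLine α ρ i₂ j₂
    × 2 ℕ.* i₁ ℕ.≤ n × n ℕ.< 2 ℕ.* i₂ × i₂ ℕ.≤ n
    × ℤ→ℚ j₁ ℚ.< lineAt α' ρ' i₁ × ℤ→ℚ j₂ ℚ.< lineAt α' ρ' i₂)

InM : (n : ℕ) → ℚ → ℚ → Vec ℤ n → Set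
InM n α ρ w =
  Σ[ α' ∈ ℚ ] Σ[ ρ' ∈ ℚ ]
    (InS α' ρ' × wordOf n α' ρ' ≡ w
    × NoGridBetween n α ρ α' ρ' × PassesAboveTwo n α ρ α' ρ')

HasSize : {A : Set} → (A → Set) → ℕ → Set
HasSize {A} P k = Σ[ xs ∈ List A ]
  (Unique xs × length xs ≡ k × (∀ w → (w ∈ xs → P w) × (P w → w ∈ xs)))

{-# OPTIONS --safe #-}
module Submission where

-- Through an integer point, ℓ takes its values on the grid (1/q)ℤ, q the denominator
-- of α. A line ℓ′ ∈ 𝒮ₙ with no grid point between it and ℓ therefore has the same
-- floors as ℓ, except at the integer points of ℓ it passes strictly below, where the
-- floor drops by one; so its word is determined by the set of integer points of ℓ it
-- passes weakly above, and different sets give different words. That set is an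
-- initial segment of the integer points when the slope of ℓ′ is at most α and a final
-- segment otherwise, and by (iii) the initial segment ends after n/2 and the final one
-- starts before n/2. Conversely, every such segment is realised by tilting ℓ by far
-- less than 1/q about a point halfway between two consecutive abscissae. Counting
-- segments, with the full one counted once, gives ℤₙ(ℓ) − 1; in the boundary cases
-- some of these tilts leave (0,1)² or contradict (iii).

open import Defs
open import Data.Nat as ℕ using (ℕ; _∸_)
open import Data.Rational as ℚ using (ℚ; 0ℚ; 1ℚ)
open import Data.Product using (_×_)
open import Relation.Binary.PropositionalEquality using (_≡_)

open import Data.Nat using (zero; suc; z≤n; s≤s; ⌊_/2⌋; ⌈_/2⌉) renaming (_≤_ to _≤ℕ_; _<_ to _<ℕ_)
import Data.Nat.Properties as ℕP
open import Data.Integer as ℤ using (ℤ; +_; -[1+_])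
import Data.Integer.Properties as ℤP
import Data.Integer.DivMod as ℤD
import Data.Integer.Solver as ℤSolver
open import Data.Rational using (mkℚ; _/_; floor; toℚᵘ)
import Data.Rational.Properties as ℚP
import Data.Rational.Solver as ℚSolver
import Data.Rational.Unnormalised as ℚᵘ
import Data.Rational.Unnormalised.Properties as ℚᵘP
open import Data.Product using (Σ-syntax; ∃-syntax; _,_; proj₁; proj₂)
open import Data.Sum using (_⊎_; inj₁; inj₂; [_,_]′)
open import Data.Empty using (⊥-elim)
open import Function using (_∘_; id)
open import Relation.Nullary using (¬_; Dec; yes; no; _×-dec_)
open import Relation.Binary.PropositionalEquality
  using (_≢_; refl; sym; trans; cong; cong₂; subst; subst₂; module ≡-Reasoning)

open import Data.Fin using (Fin; toℕ; fromℕ<)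
import Data.Fin.Properties as FP
open import Data.Vec using (Vec; lookup)
import Data.Vec.Properties as VP
open import Data.List using (List; []; _∷_; _++_; map; filter; upTo; applyUpTo; length; drop)
import Data.List.Properties as LP
open import Data.List.Membership.Propositional using (_∈_)
import Data.List.Membership.Propositional.Properties as MP
open import Data.List.Relation.Unary.Any using (here; there)
open import Data.List.Relation.Unary.All as All using (All; []; _∷_)
import Data.List.Relation.Unary.All.Properties as AllP
open import Data.List.Relation.Unary.AllPairs using (AllPairs; []; _∷_)
import Data.List.Relation.Unary.AllPairs.Properties as AllPairsP
open import Data.List.Relation.Unary.Unique.Propositional using (Unique)

module ZS = ℤSolver.+-*-Solver
open ZS using (solve; _:+_; _:-_; _:*_; _:=_; con)
module ℚS = ℚSolver.+-*-Solver

-- Integers, naturals and the floor function in ℚ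

toℚᵘ-/suc : ∀ z d → toℚᵘ (z / suc d) ℚᵘ.≃ ℚᵘ.mkℚᵘ z d
toℚᵘ-/suc z d = ℚP.toℚᵘ-fromℚᵘ (ℚᵘ.mkℚᵘ z d)

module _ {p q : ℚ} (u v : ℚᵘ.ℚᵘ) (p≃u : toℚᵘ p ℚᵘ.≃ u) (q≃v : toℚᵘ q ℚᵘ.≃ v) where

  ≡-viaℚᵘ : u ℚᵘ.≃ v → p ≡ q
  ≡-viaℚᵘ u≃v = ℚP.toℚᵘ-injective (ℚᵘP.≃-trans p≃u (ℚᵘP.≃-trans u≃v (ℚᵘP.≃-sym q≃v)))

  ≤-viaℚᵘ : u ℚᵘ.≤ v → p ℚ.≤ q
  ≤-viaℚᵘ u≤v = ℚP.toℚᵘ-cancel-≤ (ℚᵘP.≤-respˡ-≃ (ℚᵘP.≃-sym p≃u) (ℚᵘP.≤-respʳ-≃ (ℚᵘP.≃-sym q≃v) u≤v))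

  <-viaℚᵘ : u ℚᵘ.< v → p ℚ.< q
  <-viaℚᵘ u<v = ℚP.toℚᵘ-cancel-< (ℚᵘP.<-respˡ-≃ (ℚᵘP.≃-sym p≃u) (ℚᵘP.<-respʳ-≃ (ℚᵘP.≃-sym q≃v) u<v))

ℤ→ℚ-homo-+ : ∀ a b → ℤ→ℚ (a ℤ.+ b) ≡ ℤ→ℚ a ℚ.+ ℤ→ℚ b
ℤ→ℚ-homo-+ a b = ≡-viaℚᵘ (ℚᵘ.mkℚᵘ (a ℤ.+ b) 0) (ℚᵘ.mkℚᵘ a 0 ℚᵘ.+ ℚᵘ.mkℚᵘ b 0)
  (toℚᵘ-/suc _ 0)
  (ℚᵘP.≃-trans (ℚP.toℚᵘ-homo-+ (ℤ→ℚ a) (ℤ→ℚ b)) (ℚᵘP.+-cong (toℚᵘ-/suc a 0) (toℚᵘ-/suc b 0)))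
  (ℚᵘ.*≡* (solve 2 (λ a b → (a :+ b) :* con (+ 1) := (a :* con (+ 1) :+ b :* con (+ 1)) :* con (+ 1)) refl a b))

ℤ→ℚ-homo-* : ∀ a b → ℤ→ℚ (a ℤ.* b) ≡ ℤ→ℚ a ℚ.* ℤ→ℚ b
ℤ→ℚ-homo-* a b = ≡-viaℚᵘ (ℚᵘ.mkℚᵘ (a ℤ.* b) 0) (ℚᵘ.mkℚᵘ a 0 ℚᵘ.* ℚᵘ.mkℚᵘ b 0)
  (toℚᵘ-/suc _ 0)
  (ℚᵘP.≃-trans (ℚP.toℚᵘ-homo-* (ℤ→ℚ a) (ℤ→ℚ b)) (ℚᵘP.*-cong (toℚᵘ-/suc a 0) (toℚᵘ-/suc b 0)))
  (ℚᵘ.*≡* refl)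

ℤ→ℚ-homo-neg : ∀ a → ℤ→ℚ (ℤ.- a) ≡ ℚ.- ℤ→ℚ a
ℤ→ℚ-homo-neg a = begin
  ℤ→ℚ (ℤ.- a)                          ≡⟨ ℚS.solve 2 (λ x y → x ℚS.:= x ℚS.:+ y ℚS.:- y) refl (ℤ→ℚ (ℤ.- a)) (ℤ→ℚ a) ⟩
  ℤ→ℚ (ℤ.- a) ℚ.+ ℤ→ℚ a ℚ.- ℤ→ℚ a       ≡⟨ cong (ℚ._- ℤ→ℚ a) (sym (ℤ→ℚ-homo-+ (ℤ.- a) a)) ⟩
  ℤ→ℚ (ℤ.- a ℤ.+ a) ℚ.- ℤ→ℚ a           ≡⟨ cong (λ z → ℤ→ℚ z ℚ.- ℤ→ℚ a) (ℤP.+-inverseˡ a) ⟩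
  0ℚ ℚ.- ℤ→ℚ a                          ≡⟨ ℚP.+-identityˡ _ ⟩
  ℚ.- ℤ→ℚ a                             ∎
  where open ≡-Reasoning

ℤ→ℚ-mono-≤ : ∀ {a b} → a ℤ.≤ b → ℤ→ℚ a ℚ.≤ ℤ→ℚ b
ℤ→ℚ-mono-≤ {a} {b} a≤b = ≤-viaℚᵘ (ℚᵘ.mkℚᵘ a 0) (ℚᵘ.mkℚᵘ b 0) (toℚᵘ-/suc a 0) (toℚᵘ-/suc b 0)
  (ℚᵘ.*≤* (ℤP.*-monoʳ-≤-nonNeg (+ 1) a≤b))

ℤ→ℚ-mono-< : ∀ {a b} → a ℤ.< b → ℤ→ℚ a ℚ.< ℤ→ℚ b
ℤ→ℚ-mono-< {a} {b} a<b = <-viaℚᵘ (ℚᵘ.mkℚᵘ a 0) (ℚᵘ.mkℚᵘ b 0) (toℚᵘ-/suc a 0) (toℚᵘ-/suc b 0)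
  (ℚᵘ.*<* (ℤP.*-monoʳ-<-pos (+ 1) a<b))

ℤ→ℚ-cancel-< : ∀ {a b} → ℤ→ℚ a ℚ.< ℤ→ℚ b → a ℤ.< b
ℤ→ℚ-cancel-< {a} {b} a<b = subst₂ ℤ._<_ (ℤP.*-identityʳ a) (ℤP.*-identityʳ b)
  (ℚᵘP.drop-*<* (ℚᵘP.<-respˡ-≃ (toℚᵘ-/suc a 0) (ℚᵘP.<-respʳ-≃ (toℚᵘ-/suc b 0) (ℚP.toℚᵘ-mono-< a<b))))

ℕ→ℚ-mono-≤ : ∀ {i j} → i ≤ℕ j → ℕ→ℚ i ℚ.≤ ℕ→ℚ j
ℕ→ℚ-mono-≤ i≤j = ℤ→ℚ-mono-≤ (ℤ.+≤+ i≤j)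

ℕ→ℚ-mono-< : ∀ {i j} → i <ℕ j → ℕ→ℚ i ℚ.< ℕ→ℚ j
ℕ→ℚ-mono-< i<j = ℤ→ℚ-mono-< (ℤ.+<+ i<j)

ℕ→ℚ-cancel-< : ∀ {i j} → ℕ→ℚ i ℚ.< ℕ→ℚ j → i <ℕ j
ℕ→ℚ-cancel-< {i} {j} i<j = ℤP.drop‿+<+ (ℤ→ℚ-cancel-< {+ i} {+ j} i<j)

ℕ→ℚ-homo-+ : ∀ i j → ℕ→ℚ (i ℕ.+ j) ≡ ℕ→ℚ i ℚ.+ ℕ→ℚ j
ℕ→ℚ-homo-+ i j = ℤ→ℚ-homo-+ (+ i) (+ j)

0≤ℕ→ℚ : ∀ i → 0ℚ ℚ.≤ ℕ→ℚ i
0≤ℕ→ℚ i = ℕ→ℚ-mono-≤ {0} {i} z≤n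

0<1 : 0ℚ ℚ.< 1ℚ
0<1 = ℕ→ℚ-mono-< {0} {1} (s≤s z≤n)

sucℤ-injective : ∀ {x y} → ℤ.suc x ≡ ℤ.suc y → x ≡ y
sucℤ-injective {x} {y} e = trans (sym (ℤP.pred-suc x)) (trans (cong ℤ.pred e) (ℤP.pred-suc y))

floor-≤ : ∀ x → ℤ→ℚ (floor x) ℚ.≤ x
floor-≤ x@(mkℚ a d _) = ≤-viaℚᵘ (ℚᵘ.mkℚᵘ ⌊x⌋ 0) (ℚᵘ.mkℚᵘ a d) (toℚᵘ-/suc ⌊x⌋ 0) ℚᵘP.≃-refl (ℚᵘ.*≤* ⌊x⌋D≤a)
  where
  ⌊x⌋ = a ℤ./ + suc d
  ⌊x⌋D≤a : ⌊x⌋ ℤ.* + suc d ℤ.≤ a ℤ.* + 1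
  ⌊x⌋D≤a = subst (⌊x⌋ ℤ.* + suc d ℤ.≤_) (trans (sym (ℤD.a≡a%n+[a/n]*n a (+ suc d))) (sym (ℤP.*-identityʳ a)))
    (ℤP.i≤j+i (⌊x⌋ ℤ.* + suc d) (+ (a ℤ.% + suc d)))

<-suc-floor : ∀ x → x ℚ.< ℤ→ℚ (ℤ.suc (floor x))
<-suc-floor x@(mkℚ a d _) = <-viaℚᵘ (ℚᵘ.mkℚᵘ a d) (ℚᵘ.mkℚᵘ (ℤ.suc ⌊x⌋) 0) ℚᵘP.≃-refl (toℚᵘ-/suc _ 0) (ℚᵘ.*<* a<⌊x⌋D+D)
  where
  ⌊x⌋ = a ℤ./ + suc d
  a<⌊x⌋D+D : a ℤ.* + 1 ℤ.< ℤ.suc ⌊x⌋ ℤ.* + suc d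
  a<⌊x⌋D+D = subst₂ ℤ._<_ (trans (sym (ℤD.a≡a%n+[a/n]*n a (+ suc d))) (sym (ℤP.*-identityʳ a)))
    (sym (ℤP.suc-* ⌊x⌋ (+ suc d)))
    (ℤP.+-monoˡ-< (⌊x⌋ ℤ.* + suc d) (ℤ.+<+ (ℤD.n%d<d a (+ suc d))))

floor-unique : ∀ x z → ℤ→ℚ z ℚ.≤ x → x ℚ.< ℤ→ℚ (ℤ.suc z) → floor x ≡ z
floor-unique x z z≤x x<z+1 = ℤP.≤-antisym
  (<suc⇒≤ (ℤ→ℚ-cancel-< (ℚP.≤-<-trans (floor-≤ x) x<z+1)))
  (<suc⇒≤ (ℤ→ℚ-cancel-< (ℚP.≤-<-trans z≤x (<-suc-floor x))))
  where
  <suc⇒≤ : ∀ {i j} → i ℤ.< ℤ.suc j → i ℤ.≤ j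
  <suc⇒≤ {j = j} i<j+1 = subst (_ ℤ.≤_) (ℤP.pred-suc j) (ℤP.i<j⇒i≤pred[j] i<j+1)

floor-ℤ→ℚ : ∀ z → floor (ℤ→ℚ z) ≡ z
floor-ℤ→ℚ z = floor-unique (ℤ→ℚ z) z ℚP.≤-refl (ℤ→ℚ-mono-< {z} (ℤP.suc[i]≤j⇒i<j ℤP.≤-refl))

ℤ→ℚ-floor : ∀ {x z} → x ≡ ℤ→ℚ z → ℤ→ℚ (floor x) ≡ x
ℤ→ℚ-floor {z = z} refl = cong ℤ→ℚ (floor-ℤ→ℚ z)

floor-nonNeg : ∀ {x} → 0ℚ ℚ.≤ x → ∃[ k ] floor x ≡ + k
floor-nonNeg {x} 0≤x with floor x | <-suc-floor x
... | + k          | _     = k , refl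
... | -[1+ 0 ]     | x<0   = ⊥-elim (ℚP.<-irrefl refl (ℚP.≤-<-trans 0≤x x<0))
... | -[1+ suc m ] | x<-m  with ℤ→ℚ-cancel-< {+ 0} { -[1+ m ]} (ℚP.≤-<-trans 0≤x x<-m)
...   | ()

<⇒≱ : ∀ {x y} → x ℚ.< y → ¬ (y ℚ.≤ x)
<⇒≱ x<y y≤x = ℚP.<-irrefl refl (ℚP.<-≤-trans x<y y≤x)

≤⊎> : ∀ x y → x ℚ.≤ y ⊎ y ℚ.< x
≤⊎> x y with x ℚP.≤? y
... | yes x≤y = inj₁ x≤y
... | no  x≰y = inj₂ (ℚP.≰⇒> x≰y)

≤∧≢⇒< : ∀ {x y} → x ℚ.≤ y → x ≢ y → x ℚ.< y
≤∧≢⇒< {x} {y} x≤y x≢y with x ℚP.<? y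
... | yes x<y = x<y
... | no  x≮y = ⊥-elim (x≢y (ℚP.≤-antisym x≤y (ℚP.≮⇒≥ x≮y)))

+-cancelˡ-≤ : ∀ x {a b} → x ℚ.+ a ℚ.≤ x ℚ.+ b → a ℚ.≤ b
+-cancelˡ-≤ x {a} {b} x+a≤x+b = subst₂ ℚ._≤_ (-x+[x+y]≡y x a) (-x+[x+y]≡y x b) (ℚP.+-monoʳ-≤ (ℚ.- x) x+a≤x+b)
  where
  -x+[x+y]≡y : ∀ x y → ℚ.- x ℚ.+ (x ℚ.+ y) ≡ y
  -x+[x+y]≡y = ℚS.solve 2 (λ x y → ℚS.:- x ℚS.:+ (x ℚS.:+ y) ℚS.:= y) refl

+-cancelʳ-≤ : ∀ z {x y} → x ℚ.+ z ℚ.≤ y ℚ.+ z → x ℚ.≤ y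
+-cancelʳ-≤ z {x} {y} x+z≤y+z = +-cancelˡ-≤ z (subst₂ ℚ._≤_ (ℚP.+-comm x z) (ℚP.+-comm y z) x+z≤y+z)

<⇒0<- : ∀ {x y} → x ℚ.< y → 0ℚ ℚ.< y ℚ.- x
<⇒0<- {x} {y} x<y = subst (ℚ._< y ℚ.- x) (ℚP.+-inverseʳ x) (ℚP.+-monoˡ-< (ℚ.- x) x<y)

<⇒-<0 : ∀ {x y} → x ℚ.< y → x ℚ.- y ℚ.< 0ℚ
<⇒-<0 {x} {y} x<y = subst (x ℚ.- y ℚ.<_) (ℚP.+-inverseʳ y) (ℚP.+-monoˡ-< (ℚ.- y) x<y)

≤⇒0≤- : ∀ {x y} → x ℚ.≤ y → 0ℚ ℚ.≤ y ℚ.- x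
≤⇒0≤- {x} {y} x≤y = subst (ℚ._≤ y ℚ.- x) (ℚP.+-inverseʳ x) (ℚP.+-monoˡ-≤ (ℚ.- x) x≤y)

≤⇒-≤0 : ∀ {x y} → x ℚ.≤ y → x ℚ.- y ℚ.≤ 0ℚ
≤⇒-≤0 {x} {y} x≤y = subst (x ℚ.- y ℚ.≤_) (ℚP.+-inverseʳ y) (ℚP.+-monoˡ-≤ (ℚ.- y) x≤y)

x<x+p : ∀ x {p} → 0ℚ ℚ.< p → x ℚ.< x ℚ.+ p
x<x+p x {p} 0<p = subst (ℚ._< x ℚ.+ p) (ℚP.+-identityʳ x) (ℚP.+-monoʳ-< x 0<p)

x+p<x : ∀ x {p} → p ℚ.< 0ℚ → x ℚ.+ p ℚ.< x
x+p<x x {p} p<0 = subst (x ℚ.+ p ℚ.<_) (ℚP.+-identityʳ x) (ℚP.+-monoʳ-< x p<0)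

*-pos : ∀ {x y} → 0ℚ ℚ.< x → 0ℚ ℚ.< y → 0ℚ ℚ.< x ℚ.* y
*-pos {x} {y} 0<x 0<y = ℚP.positive⁻¹ (x ℚ.* y) {{ℚP.pos*pos⇒pos x {{ℚ.positive 0<x}} y {{ℚ.positive 0<y}}}}

-- Grids of mesh 1 / (d + 1)

module Grid (d : ℕ) where

  scale : ℚ
  scale = ℕ→ℚ (suc d)

  mesh : ℚ
  mesh = + 1 / suc d

  record OnGrid (x : ℚ) : Set where
    constructor onGrid
    field
      num    : ℤ
      scaled : x ℚ.* scale ≡ ℤ→ℚ num

  mesh*scale≡1 : mesh ℚ.* scale ≡ 1ℚ
  mesh*scale≡1 = ≡-viaℚᵘ (ℚᵘ.mkℚᵘ (+ 1) d ℚᵘ.* ℚᵘ.mkℚᵘ (+ suc d) 0) (ℚᵘ.mkℚᵘ (+ 1) 0)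
    (ℚᵘP.≃-trans (ℚP.toℚᵘ-homo-* mesh scale) (ℚᵘP.*-cong (toℚᵘ-/suc (+ 1) d) (toℚᵘ-/suc (+ suc d) 0)))
    (toℚᵘ-/suc (+ 1) 0)
    (ℚᵘ.*≡* (trans (ℤP.*-identityʳ _) (trans (ℤP.*-identityˡ (+ suc d))
       (trans (cong +_ (sym (ℕP.*-identityʳ (suc d)))) (sym (ℤP.*-identityˡ _))))))

  0<scale : 0ℚ ℚ.< scale
  0<scale = ℕ→ℚ-mono-< {0} {suc d} (s≤s z≤n)

  0<mesh : 0ℚ ℚ.< mesh
  0<mesh = ℚP.*-cancelʳ-<-nonNeg scale {{ℚ.nonNegative (ℚP.<⇒≤ 0<scale)}}
    (subst₂ ℚ._<_ (sym (ℚP.*-zeroˡ scale)) (sym mesh*scale≡1) 0<1)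

  OnGrid-ℤ : ∀ z → OnGrid (ℤ→ℚ z)
  OnGrid-ℤ z = onGrid (z ℤ.* + suc d) (sym (ℤ→ℚ-homo-* z (+ suc d)))

  OnGrid-+ : ∀ {x y} → OnGrid x → OnGrid y → OnGrid (x ℚ.+ y)
  OnGrid-+ {x} {y} (onGrid N xD≡N) (onGrid M yD≡M) = onGrid (N ℤ.+ M)
    (trans (ℚP.*-distribʳ-+ scale x y) (trans (cong₂ ℚ._+_ xD≡N yD≡M) (sym (ℤ→ℚ-homo-+ N M))))

  OnGrid-neg : ∀ {x} → OnGrid x → OnGrid (ℚ.- x)
  OnGrid-neg {x} (onGrid N xD≡N) = onGrid (ℤ.- N)
    (trans (sym (ℚP.neg-distribˡ-* x scale)) (trans (cong ℚ.-_ xD≡N) (sym (ℤ→ℚ-homo-neg N))))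

  OnGrid-*ℤ : ∀ {x} z → OnGrid x → OnGrid (x ℚ.* ℤ→ℚ z)
  OnGrid-*ℤ {x} z (onGrid N xD≡N) = onGrid (N ℤ.* z)
    (trans (swap x (ℤ→ℚ z) scale) (trans (cong (ℚ._* ℤ→ℚ z) xD≡N) (sym (ℤ→ℚ-homo-* N z))))
    where
    swap : ∀ a b c → a ℚ.* b ℚ.* c ≡ a ℚ.* c ℚ.* b
    swap = ℚS.solve 3 (λ a b c → a ℚS.:* b ℚS.:* c ℚS.:= a ℚS.:* c ℚS.:* b) refl

  OnGrid-pos⇒mesh≤ : ∀ {x} → OnGrid x → 0ℚ ℚ.< x → mesh ℚ.≤ x
  OnGrid-pos⇒mesh≤ {x} (onGrid N xD≡N) 0<x = ℚP.*-cancelʳ-≤-pos scale {{ℚ.positive 0<scale}}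
    (subst₂ ℚ._≤_ (sym mesh*scale≡1) (sym xD≡N) (ℤ→ℚ-mono-≤ (ℤP.i<j⇒suc[i]≤j (ℤ→ℚ-cancel-< {+ 0} {N} 0<N))))
    where
    0<N : 0ℚ ℚ.< ℤ→ℚ N
    0<N = subst₂ ℚ._<_ (ℚP.*-zeroˡ scale) xD≡N (ℚP.*-monoˡ-<-pos scale {{ℚ.positive 0<scale}} 0<x)

  OnGrid-<⇒+mesh≤ : ∀ {x y} → OnGrid x → OnGrid y → x ℚ.< y → x ℚ.+ mesh ℚ.≤ y
  OnGrid-<⇒+mesh≤ {x} {y} gx gy x<y = subst₂ ℚ._≤_ (ℚP.+-comm mesh x) ([y-x]+x≡y x y)
    (ℚP.+-monoˡ-≤ x (OnGrid-pos⇒mesh≤ (OnGrid-+ gy (OnGrid-neg gx)) (<⇒0<- x<y)))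
    where
    [y-x]+x≡y : ∀ x y → (y ℚ.- x) ℚ.+ x ≡ y
    [y-x]+x≡y = ℚS.solve 2 (λ x y → (y ℚS.:- x) ℚS.:+ x ℚS.:= y) refl

OnGrid-self : ∀ α → Grid.OnGrid (ℚ.denominator-1 α) α
OnGrid-self α@(mkℚ a d _) = Grid.onGrid a (≡-viaℚᵘ (ℚᵘ.mkℚᵘ a d ℚᵘ.* ℚᵘ.mkℚᵘ (+ suc d) 0) (ℚᵘ.mkℚᵘ a 0)
  (ℚᵘP.≃-trans (ℚP.toℚᵘ-homo-* α (ℕ→ℚ (suc d))) (ℚᵘP.*-cong ℚᵘP.≃-refl (toℚᵘ-/suc (+ suc d) 0)))
  (toℚᵘ-/suc a 0)
  (ℚᵘ.*≡* (trans (ℤP.*-identityʳ _) (cong (a ℤ.*_) (cong +_ (sym (ℕP.*-identityʳ (suc d))))))))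

-- Bounded search, halving and sorted lists

module BoundedSearch {Q : ℕ → Set} (Q? : ∀ k → Dec (Q k)) where

  private
    leastBelow : ∀ b → (∀ k → k <ℕ b → ¬ Q k) ⊎ Σ[ m ∈ ℕ ] Q m × m <ℕ b × (∀ k → k <ℕ m → ¬ Q k)
    leastBelow zero = inj₁ (λ k ())
    leastBelow (suc b) with leastBelow b | Q? b
    ... | inj₂ (m , Qm , m<b , least) | _     = inj₂ (m , Qm , ℕP.m<n⇒m<1+n m<b , least)
    ... | inj₁ none                   | yes Qb = inj₂ (b , Qb , ℕP.n<1+n b , none)
    ... | inj₁ none                   | no ¬Qb = inj₁ λ k k<1+b →
      [ none k , (λ { refl → ¬Qb }) ]′ (ℕP.m≤n⇒m<n∨m≡n (ℕP.≤-pred k<1+b))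

  least : ∀ p → Q p → Σ[ m ∈ ℕ ] Q m × m ≤ℕ p × (∀ k → k <ℕ m → ¬ Q k)
  least p Qp with leastBelow (suc p)
  ... | inj₁ none                  = ⊥-elim (none p (ℕP.n<1+n p) Qp)
  ... | inj₂ (m , Qm , m<1+p , lt) = m , Qm , ℕP.≤-pred m<1+p , lt

  greatest : ∀ n p → Q p → p ≤ℕ n →
             Σ[ M ∈ ℕ ] Q M × p ≤ℕ M × M ≤ℕ n × (∀ k → M <ℕ k → k ≤ℕ n → ¬ Q k)
  greatest zero p Qp p≤0 = p , Qp , ℕP.≤-refl , p≤0 , λ k p<k k≤0 _ → ℕP.<⇒≱ p<k (ℕP.≤-trans k≤0 z≤n)
  greatest (suc n) p Qp p≤1+n with Q? (suc n)
  ... | yes Q1+n = suc n , Q1+n , p≤1+n , ℕP.≤-refl , λ k n<k k≤n _ → ℕP.<⇒≱ n<k k≤n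
  ... | no ¬Q1+n with ℕP.m≤n⇒m<n∨m≡n p≤1+n
  ...   | inj₂ refl = ⊥-elim (¬Q1+n Qp)
  ...   | inj₁ p<1+n with greatest n p Qp (ℕP.≤-pred p<1+n)
  ...     | M , QM , p≤M , M≤n , above = M , QM , p≤M , ℕP.m≤n⇒m≤1+n M≤n , λ k M<k k≤1+n →
    [ above k M<k ∘ ℕP.≤-pred , (λ { refl → ¬Q1+n }) ]′ (ℕP.m≤n⇒m<n∨m≡n k≤1+n)

2*x≡x+x : ∀ x → 2 ℕ.* x ≡ x ℕ.+ x
2*x≡x+x x = cong (x ℕ.+_) (ℕP.+-identityʳ x)

2*t≤n⇒t≤⌊n/2⌋ : ∀ {n t} → 2 ℕ.* t ≤ℕ n → t ≤ℕ ⌊ n /2⌋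
2*t≤n⇒t≤⌊n/2⌋ {n} {t} 2t≤n = subst (_≤ℕ ⌊ n /2⌋) (sym (ℕP.n≡⌊n+n/2⌋ t))
  (ℕP.⌊n/2⌋-mono (subst (_≤ℕ n) (2*x≡x+x t) 2t≤n))

t≤⌊n/2⌋⇒2*t≤n : ∀ {n t} → t ≤ℕ ⌊ n /2⌋ → 2 ℕ.* t ≤ℕ n
t≤⌊n/2⌋⇒2*t≤n {n} {t} t≤n/2 = subst (2 ℕ.* t ≤ℕ_) (ℕP.⌊n/2⌋+⌈n/2⌉≡n n)
  (subst (_≤ℕ ⌊ n /2⌋ ℕ.+ ⌈ n /2⌉) (sym (2*x≡x+x t))
    (ℕP.+-mono-≤ t≤n/2 (ℕP.≤-trans t≤n/2 (ℕP.⌊n/2⌋≤⌈n/2⌉ n))))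

n<2*t⇒⌊n/2⌋<t : ∀ {n t} → n <ℕ 2 ℕ.* t → ⌊ n /2⌋ <ℕ t
n<2*t⇒⌊n/2⌋<t n<2t = ℕP.≰⇒> (ℕP.<⇒≱ n<2t ∘ t≤⌊n/2⌋⇒2*t≤n)

⌊n/2⌋<t⇒n<2*t : ∀ {n t} → ⌊ n /2⌋ <ℕ t → n <ℕ 2 ℕ.* t
⌊n/2⌋<t⇒n<2*t n/2<t = ℕP.≰⇒> (ℕP.<⇒≱ n/2<t ∘ 2*t≤n⇒t≤⌊n/2⌋)

applyUpTo-+ : ∀ {A : Set} (f : ℕ → A) a b →
              applyUpTo f (a ℕ.+ b) ≡ applyUpTo f a ++ applyUpTo (λ k → f (a ℕ.+ k)) b
applyUpTo-+ f zero    b = refl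
applyUpTo-+ f (suc a) b = cong (f 0 ∷_) (applyUpTo-+ (f ∘ suc) a b)

Sorted : List ℕ → Set
Sorted = AllPairs _<ℕ_

map-unique : ∀ {B : Set} (f : ℕ → B) {xs} → Sorted xs →
             (∀ {x y} → x ∈ xs → y ∈ xs → x <ℕ y → f x ≢ f y) → Unique (map f xs)
map-unique f {[]}     []               separates = []
map-unique f {x ∷ xs} (x<xs ∷ sorted) separates =
  AllP.map⁺ (All.tabulate λ y∈xs → separates (here refl) (there y∈xs) (All.lookup x<xs y∈xs))
  ∷ map-unique f sorted (λ x∈ y∈ → separates (there x∈) (there y∈))

∈-map⇒ : ∀ {A B : Set} {P : B → Set} (f : A → B) {xs w} → (∀ {t} → t ∈ xs → P (f t)) → w ∈ map f xs → P w
∈-map⇒ {P = P} f f∈P w∈ = let t , t∈ , w≡ft = MP.∈-map⁻ f w∈ in subst P (sym w≡ft) (f∈P t∈)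

HasSize-intro : ∀ {A : Set} {P : A → Set} {k} (xs : List A) → Unique xs → length xs ≡ k →
                (∀ {w} → w ∈ xs → P w) → (∀ {w} → P w → w ∈ xs) → HasSize P k
HasSize-intro xs unique len sound complete = xs , unique , len , λ w → sound , complete

drop1⊆ : ∀ {x} {xs : List ℕ} → x ∈ drop 1 xs → x ∈ xs
drop1⊆ {xs = _ ∷ _} x∈ = there x∈

∈-drop1⊎minimum : ∀ {t xs} → Sorted xs → t ∈ xs → t ∈ drop 1 xs ⊎ (∀ {x} → x ∈ xs → t ≤ℕ x)
∈-drop1⊎minimum (t<xs ∷ _) (here refl) = inj₂ λ { (here refl) → ℕP.≤-refl ; (there x∈) → ℕP.<⇒≤ (All.lookup t<xs x∈) }
∈-drop1⊎minimum _          (there t∈)  = inj₁ t∈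

∈-drop1⇒head< : ∀ {t xs} → Sorted xs → t ∈ drop 1 xs → Σ[ y ∈ ℕ ] y ∈ xs × y <ℕ t
∈-drop1⇒head< {xs = y ∷ _} (y<xs ∷ _) t∈ = y , here refl , All.lookup y<xs t∈

two-members : ∀ {xs} → Sorted xs → 2 ≤ℕ length xs → Σ[ p ∈ ℕ ] Σ[ q ∈ ℕ ] p ∈ xs × q ∈ xs × p <ℕ q
two-members {p ∷ q ∷ _} ((p<q ∷ _) ∷ _) _ = p , q , here refl , there (here refl) , p<q
two-members {_ ∷ []}    _                (s≤s ())

-- Words and lines

wordOf-cong : ∀ n {a r a′ r′} → (∀ i → i ≤ℕ n → floor (lineAt a r i) ≡ floor (lineAt a′ r′ i)) →
              wordOf n a r ≡ wordOf n a′ r′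
wordOf-cong n same = VP.tabulate-cong λ k →
  cong₂ ℤ._-_ (same (suc (toℕ k)) (FP.toℕ<n k)) (same (toℕ k) (ℕP.<⇒≤ (FP.toℕ<n k)))

wordOf≡⇒floor≡ : ∀ n {a r a′ r′} → floor (lineAt a r 0) ≡ floor (lineAt a′ r′ 0) →
                 wordOf n a r ≡ wordOf n a′ r′ → ∀ i → i ≤ℕ n → floor (lineAt a r i) ≡ floor (lineAt a′ r′ i)
wordOf≡⇒floor≡ n same₀ _ zero _ = same₀
wordOf≡⇒floor≡ n {a} {r} {a′} {r′} same₀ w≡w′ (suc i) i<n = begin
  F (suc i)                   ≡⟨ solve 2 (λ x y → x := x :- y :+ y) refl (F (suc i)) (F i) ⟩
  F (suc i) ℤ.- F i ℤ.+ F i    ≡⟨ cong₂ ℤ._+_ letter≡ (wordOf≡⇒floor≡ n {a} {r} {a′} {r′} same₀ w≡w′ i (ℕP.<⇒≤ i<n)) ⟩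
  F′ (suc i) ℤ.- F′ i ℤ.+ F′ i ≡⟨ solve 2 (λ x y → x :- y :+ y := x) refl (F′ (suc i)) (F′ i) ⟩
  F′ (suc i)                  ∎
  where
  open ≡-Reasoning
  F F′ : ℕ → ℤ
  F j = floor (lineAt a r j)
  F′ j = floor (lineAt a′ r′ j)
  k : Fin n
  k = fromℕ< i<n
  letter≡ : F (suc i) ℤ.- F i ≡ F′ (suc i) ℤ.- F′ i
  letter≡ = subst (λ j → F (suc j) ℤ.- F j ≡ F′ (suc j) ℤ.- F′ j) (FP.toℕ-fromℕ< i<n)
    (trans (sym (VP.lookup∘tabulate _ k)) (trans (cong (λ v → lookup v k) w≡w′) (VP.lookup∘tabulate _ k)))

lineAt-0 : ∀ a r → lineAt a r 0 ≡ r
lineAt-0 a r = trans (cong (ℚ._+ r) (ℚP.*-zeroʳ a)) (ℚP.+-identityˡ r)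

0≤a*i : ∀ {a} → 0ℚ ℚ.≤ a → ∀ i → 0ℚ ℚ.≤ a ℚ.* ℕ→ℚ i
0≤a*i {a} 0≤a i = subst (ℚ._≤ a ℚ.* ℕ→ℚ i) (ℚP.*-zeroʳ a) (ℚP.*-monoˡ-≤-nonNeg a {{ℚ.nonNegative 0≤a}} (0≤ℕ→ℚ i))

0≤lineAt : ∀ {a r} → 0ℚ ℚ.≤ a → 0ℚ ℚ.≤ r → ∀ i → 0ℚ ℚ.≤ lineAt a r i
0≤lineAt 0≤a 0≤r i = ℚP.+-mono-≤ (0≤a*i 0≤a i) 0≤r

0<lineAt : ∀ {a r} → 0ℚ ℚ.≤ a → 0ℚ ℚ.< r → ∀ i → 0ℚ ℚ.< lineAt a r i
0<lineAt 0≤a 0<r i = ℚP.+-mono-≤-< (0≤a*i 0≤a i) 0<r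

private
  a*i≤i : ∀ {a} → a ℚ.≤ 1ℚ → ∀ i → a ℚ.* ℕ→ℚ i ℚ.≤ ℕ→ℚ i
  a*i≤i {a} a≤1 i = subst (a ℚ.* ℕ→ℚ i ℚ.≤_) (ℚP.*-identityˡ (ℕ→ℚ i))
    (ℚP.*-monoʳ-≤-nonNeg (ℕ→ℚ i) {{ℚ.nonNegative (0≤ℕ→ℚ i)}} a≤1)

  i+1≡1+i : ∀ i → ℕ→ℚ i ℚ.+ 1ℚ ≡ ℕ→ℚ (suc i)
  i+1≡1+i i = trans (ℚP.+-comm (ℕ→ℚ i) 1ℚ) (sym (ℕ→ℚ-homo-+ 1 i))

lineAt≤suc : ∀ {a r} → a ℚ.≤ 1ℚ → r ℚ.≤ 1ℚ → ∀ i → lineAt a r i ℚ.≤ ℕ→ℚ (suc i)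
lineAt≤suc {a} {r} a≤1 r≤1 i = subst (lineAt a r i ℚ.≤_) (i+1≡1+i i) (ℚP.+-mono-≤ (a*i≤i a≤1 i) r≤1)

lineAt<suc : ∀ {a r} → a ℚ.≤ 1ℚ → r ℚ.< 1ℚ → ∀ i → lineAt a r i ℚ.< ℕ→ℚ (suc i)
lineAt<suc {a} {r} a≤1 r<1 i = subst (lineAt a r i ℚ.<_) (i+1≡1+i i) (ℚP.+-mono-≤-< (a*i≤i a≤1 i) r<1)

lineAt-mono-≤-< : ∀ {a r a′ r′} → a ℚ.≤ a′ → r ℚ.< r′ → ∀ i → lineAt a r i ℚ.< lineAt a′ r′ i
lineAt-mono-≤-< a≤a′ r<r′ i =
  ℚP.+-mono-≤-< (ℚP.*-monoʳ-≤-nonNeg (ℕ→ℚ i) {{ℚ.nonNegative (0≤ℕ→ℚ i)}} a≤a′) r<r′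

private
  lineAt-≤-transport : ∀ {a r a′ r′} x y → lineAt a r x ℚ.≤ lineAt a′ r′ x →
    (a ℚ.- a′) ℚ.* ℕ→ℚ y ℚ.≤ (a ℚ.- a′) ℚ.* ℕ→ℚ x → lineAt a r y ℚ.≤ lineAt a′ r′ y
  lineAt-≤-transport {a} {r} {a′} {r′} x y at-x slopes = +-cancelʳ-≤ (a ℚ.* X ℚ.- a′ ℚ.* Y)
    (subst₂ ℚ._≤_ (left a r a′ X Y) (right a r′ a′ X Y) (ℚP.+-mono-≤ at-x slopes))
    where
    X = ℕ→ℚ x
    Y = ℕ→ℚ y
    left : ∀ a r a′ X Y → a ℚ.* X ℚ.+ r ℚ.+ (a ℚ.- a′) ℚ.* Y ≡ a ℚ.* Y ℚ.+ r ℚ.+ (a ℚ.* X ℚ.- a′ ℚ.* Y)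
    left = ℚS.solve 5 (λ a r a′ X Y → a ℚS.:* X ℚS.:+ r ℚS.:+ (a ℚS.:- a′) ℚS.:* Y
                          ℚS.:= a ℚS.:* Y ℚS.:+ r ℚS.:+ (a ℚS.:* X ℚS.:- a′ ℚS.:* Y)) refl
    right : ∀ a r′ a′ X Y → a′ ℚ.* X ℚ.+ r′ ℚ.+ (a ℚ.- a′) ℚ.* X ≡ a′ ℚ.* Y ℚ.+ r′ ℚ.+ (a ℚ.* X ℚ.- a′ ℚ.* Y)
    right = ℚS.solve 5 (λ a r′ a′ X Y → a′ ℚS.:* X ℚS.:+ r′ ℚS.:+ (a ℚS.:- a′) ℚS.:* X
                           ℚS.:= a′ ℚS.:* Y ℚS.:+ r′ ℚS.:+ (a ℚS.:* X ℚS.:- a′ ℚS.:* Y)) refl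

lineAt-≤-leftward : ∀ {a r a′ r′} → a′ ℚ.≤ a → ∀ {x y} → y ≤ℕ x →
                    lineAt a r x ℚ.≤ lineAt a′ r′ x → lineAt a r y ℚ.≤ lineAt a′ r′ y
lineAt-≤-leftward {a} {r} {a′} {r′} a′≤a {x} {y} y≤x at-x = lineAt-≤-transport {a} {r} {a′} {r′} x y at-x
  (ℚP.*-monoˡ-≤-nonNeg (a ℚ.- a′) {{ℚ.nonNegative (≤⇒0≤- a′≤a)}} (ℕ→ℚ-mono-≤ y≤x))

lineAt-≤-rightward : ∀ {a r a′ r′} → a ℚ.≤ a′ → ∀ {x y} → x ≤ℕ y →
                     lineAt a r x ℚ.≤ lineAt a′ r′ x → lineAt a r y ℚ.≤ lineAt a′ r′ y
lineAt-≤-rightward {a} {r} {a′} {r′} a≤a′ {x} {y} x≤y at-x = lineAt-≤-transport {a} {r} {a′} {r′} x y at-x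
  (ℚP.*-monoˡ-≤-nonPos (a ℚ.- a′) {{ℚ.nonPositive (≤⇒-≤0 a≤a′)}} (ℕ→ℚ-mono-≤ x≤y))

integral-reflect : ∀ a r {x y z} → ℤ→ℚ (floor (lineAt a r x)) ≡ lineAt a r x →
  ℤ→ℚ (floor (lineAt a r y)) ≡ lineAt a r y → z ℕ.+ x ≡ y ℕ.+ y →
  ℤ→ℚ (floor (lineAt a r z)) ≡ lineAt a r z
integral-reflect a r {x} {y} {z} int-x int-y z+x≡2y = ℤ→ℚ-floor {z = Fy ℤ.+ Fy ℤ.- Fx} (begin
  a ℚ.* Z ℚ.+ r                                   ≡⟨ cong (λ v → a ℚ.* v ℚ.+ r) Z≡2Y-X ⟩
  a ℚ.* (Y ℚ.+ Y ℚ.- X) ℚ.+ r                      ≡⟨ expand a r Y X ⟩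
  lineAt a r y ℚ.+ lineAt a r y ℚ.- lineAt a r x  ≡⟨ cong₂ (λ u v → u ℚ.+ u ℚ.- v) (sym int-y) (sym int-x) ⟩
  ℤ→ℚ Fy ℚ.+ ℤ→ℚ Fy ℚ.- ℤ→ℚ Fx                     ≡⟨ sym (cong₂ ℚ._+_ (ℤ→ℚ-homo-+ Fy Fy) (ℤ→ℚ-homo-neg Fx)) ⟩
  ℤ→ℚ (Fy ℤ.+ Fy) ℚ.+ ℤ→ℚ (ℤ.- Fx)                 ≡⟨ sym (ℤ→ℚ-homo-+ (Fy ℤ.+ Fy) (ℤ.- Fx)) ⟩
  ℤ→ℚ (Fy ℤ.+ Fy ℤ.- Fx)                          ∎)
  where
  open ≡-Reasoning
  X = ℕ→ℚ x
  Y = ℕ→ℚ y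
  Z = ℕ→ℚ z
  Fx = floor (lineAt a r x)
  Fy = floor (lineAt a r y)
  Z≡2Y-X : Z ≡ Y ℚ.+ Y ℚ.- X
  Z≡2Y-X = begin
    Z                  ≡⟨ ℚS.solve 2 (λ z x → z ℚS.:= z ℚS.:+ x ℚS.:- x) refl Z X ⟩
    Z ℚ.+ X ℚ.- X      ≡⟨ cong (ℚ._- X) (sym (ℕ→ℚ-homo-+ z x)) ⟩
    ℕ→ℚ (z ℕ.+ x) ℚ.- X ≡⟨ cong (λ k → ℕ→ℚ k ℚ.- X) z+x≡2y ⟩
    ℕ→ℚ (y ℕ.+ y) ℚ.- X ≡⟨ cong (ℚ._- X) (ℕ→ℚ-homo-+ y y) ⟩
    Y ℚ.+ Y ℚ.- X      ∎
  expand : ∀ a r Y X → a ℚ.* (Y ℚ.+ Y ℚ.- X) ℚ.+ r ≡ (a ℚ.* Y ℚ.+ r) ℚ.+ (a ℚ.* Y ℚ.+ r) ℚ.- (a ℚ.* X ℚ.+ r)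
  expand = ℚS.solve 4 (λ a r Y X → a ℚS.:* (Y ℚS.:+ Y ℚS.:- X) ℚS.:+ r
                          ℚS.:= (a ℚS.:* Y ℚS.:+ r) ℚS.:+ (a ℚS.:* Y ℚS.:+ r) ℚS.:- (a ℚS.:* X ℚS.:+ r)) refl

floor-InS-0 : ∀ {a r} → InS a r → floor (lineAt a r 0) ≡ + 0
floor-InS-0 {a} {r} (_ , (0<r , r<1)) = trans (cong floor (lineAt-0 a r)) (floor-unique r (+ 0) (ℚP.<⇒≤ 0<r) r<1)

-- Lines close to y = α x + ρ

module Line (n : ℕ) (α ρ : ℚ) (0≤α : 0ℚ ℚ.≤ α) (α≤1 : α ℚ.≤ 1ℚ) (0≤ρ : 0ℚ ℚ.≤ ρ) (ρ≤1 : ρ ℚ.≤ 1ℚ) where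

  ℓ : ℕ → ℚ
  ℓ = lineAt α ρ

  Integral : ℕ → Set
  Integral i = ℤ→ℚ (floor (ℓ i)) ≡ ℓ i

  integral? : ∀ i → Dec (Integral i)
  integral? i = ℤ→ℚ (floor (ℓ i)) ℚP.≟ ℓ i

  onLine⇒integral : ∀ {i z} → OnLine α ρ i z → Integral i
  onLine⇒integral {z = z} = ℤ→ℚ-floor {z = z}

  Admissible : ℚ → ℚ → Set
  Admissible a r = InS a r × NoGridBetween n α ρ a r

  module _ {a r} (adm : Admissible a r) where

    0<slope : 0ℚ ℚ.< a
    0<slope = proj₁ (proj₁ (proj₁ adm))

    slope<1 : a ℚ.< 1ℚ
    slope<1 = proj₂ (proj₁ (proj₁ adm))

    0<intercept : 0ℚ ℚ.< r
    0<intercept = proj₁ (proj₂ (proj₁ adm))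

    intercept<1 : r ℚ.< 1ℚ
    intercept<1 = proj₂ (proj₂ (proj₁ adm))

  ⌊ℓ_⌋ : ℕ → ℕ
  ⌊ℓ i ⌋ = proj₁ (floor-nonNeg (0≤lineAt 0≤α 0≤ρ i))

  floor-ℓ : ∀ i → floor (ℓ i) ≡ + ⌊ℓ i ⌋
  floor-ℓ i = proj₂ (floor-nonNeg (0≤lineAt 0≤α 0≤ρ i))

  ⌊ℓ⌋≤ℓ : ∀ i → ℕ→ℚ ⌊ℓ i ⌋ ℚ.≤ ℓ i
  ⌊ℓ⌋≤ℓ i = subst (λ z → ℤ→ℚ z ℚ.≤ ℓ i) (floor-ℓ i) (floor-≤ (ℓ i))

  ℓ<⌊ℓ⌋+1 : ∀ i → ℓ i ℚ.< ℕ→ℚ (suc ⌊ℓ i ⌋)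
  ℓ<⌊ℓ⌋+1 i = subst (λ z → ℓ i ℚ.< ℤ→ℚ (ℤ.suc z)) (floor-ℓ i) (<-suc-floor (ℓ i))

  module _ {a r} (adm : Admissible a r) {i} (i≤n : i ≤ℕ n) where

    private
      noGrid = proj₂ adm

    no-grid-above : ∀ {j} → ℓ i ℚ.< ℕ→ℚ j → ¬ (ℕ→ℚ j ℚ.≤ lineAt a r i)
    no-grid-above {j} ℓ<j j≤ℓ′ = noGrid i j i≤n j≤n (inj₁ (ℓ<j , j≤ℓ′))
      where
      j≤n = ℕP.≤-trans (ℕP.≤-pred (ℕ→ℚ-cancel-< (ℚP.≤-<-trans j≤ℓ′ (lineAt<suc (ℚP.<⇒≤ (slope<1 adm)) (intercept<1 adm) i)))) i≤n

    no-grid-below : ∀ {j} → ℕ→ℚ j ℚ.< ℓ i → ¬ (lineAt a r i ℚ.≤ ℕ→ℚ j)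
    no-grid-below {j} j<ℓ ℓ′≤j = noGrid i j i≤n j≤n (inj₂ (ℓ′≤j , j<ℓ))
      where
      j≤n = ℕP.≤-trans (ℕP.≤-pred (ℕ→ℚ-cancel-< (ℚP.<-≤-trans j<ℓ (lineAt≤suc α≤1 ρ≤1 i)))) i≤n

    floor-above : ℓ i ℚ.≤ lineAt a r i → floor (lineAt a r i) ≡ floor (ℓ i)
    floor-above ℓ≤ℓ′ = trans (floor-unique (lineAt a r i) (+ ⌊ℓ i ⌋) (ℚP.≤-trans (⌊ℓ⌋≤ℓ i) ℓ≤ℓ′) ℓ′<⌊ℓ⌋+1) (sym (floor-ℓ i))
      where
      ℓ′<⌊ℓ⌋+1 : lineAt a r i ℚ.< ℕ→ℚ (suc ⌊ℓ i ⌋)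
      ℓ′<⌊ℓ⌋+1 = ℚP.≰⇒> (no-grid-above {suc ⌊ℓ i ⌋} (ℓ<⌊ℓ⌋+1 i))

    floor-below-nonIntegral : lineAt a r i ℚ.< ℓ i → ¬ Integral i → floor (lineAt a r i) ≡ floor (ℓ i)
    floor-below-nonIntegral ℓ′<ℓ ¬int =
      trans (floor-unique (lineAt a r i) (+ ⌊ℓ i ⌋) ⌊ℓ⌋≤ℓ′ (ℚP.<-trans ℓ′<ℓ (ℓ<⌊ℓ⌋+1 i))) (sym (floor-ℓ i))
      where
      ⌊ℓ⌋<ℓ : ℕ→ℚ ⌊ℓ i ⌋ ℚ.< ℓ i
      ⌊ℓ⌋<ℓ = ≤∧≢⇒< (⌊ℓ⌋≤ℓ i) (λ ⌊ℓ⌋≡ℓ → ¬int (trans (cong ℤ→ℚ (floor-ℓ i)) ⌊ℓ⌋≡ℓ))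
      ⌊ℓ⌋≤ℓ′ : ℕ→ℚ ⌊ℓ i ⌋ ℚ.≤ lineAt a r i
      ⌊ℓ⌋≤ℓ′ = ℚP.<⇒≤ (ℚP.≰⇒> (no-grid-below {⌊ℓ i ⌋} ⌊ℓ⌋<ℓ))

    floor-nonIntegral : ¬ Integral i → floor (lineAt a r i) ≡ floor (ℓ i)
    floor-nonIntegral ¬int = [ floor-above , (λ ℓ′<ℓ → floor-below-nonIntegral ℓ′<ℓ ¬int) ]′ (≤⊎> (ℓ i) (lineAt a r i))

    floor-below-integral : lineAt a r i ℚ.< ℓ i → Integral i → ℤ.suc (floor (lineAt a r i)) ≡ floor (ℓ i)
    floor-below-integral ℓ′<ℓ int = go ⌊ℓ i ⌋ (floor-ℓ i)
      where
      ℓ≡ : ∀ {k} → floor (ℓ i) ≡ + k → ℓ i ≡ ℕ→ℚ k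
      ℓ≡ ⌊ℓ⌋≡k = trans (sym int) (cong ℤ→ℚ ⌊ℓ⌋≡k)
      go : ∀ k → floor (ℓ i) ≡ + k → ℤ.suc (floor (lineAt a r i)) ≡ floor (ℓ i)
      go zero ⌊ℓ⌋≡0 = ⊥-elim (<⇒≱ (0<lineAt (ℚP.<⇒≤ (0<slope adm)) (0<intercept adm) i) (ℚP.<⇒≤ (subst (lineAt a r i ℚ.<_) (ℓ≡ ⌊ℓ⌋≡0) ℓ′<ℓ)))
      go (suc k) ⌊ℓ⌋≡k+1 = trans (cong ℤ.suc (floor-unique (lineAt a r i) (+ k) k≤ℓ′ ℓ′<k+1)) (sym ⌊ℓ⌋≡k+1)
        where
        ℓ′<k+1 : lineAt a r i ℚ.< ℕ→ℚ (suc k)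
        ℓ′<k+1 = subst (lineAt a r i ℚ.<_) (ℓ≡ ⌊ℓ⌋≡k+1) ℓ′<ℓ
        k<ℓ : ℕ→ℚ k ℚ.< ℓ i
        k<ℓ = subst (ℕ→ℚ k ℚ.<_) (sym (ℓ≡ ⌊ℓ⌋≡k+1)) (ℕ→ℚ-mono-< {k} ℕP.≤-refl)
        k≤ℓ′ : ℕ→ℚ k ℚ.≤ lineAt a r i
        k≤ℓ′ = ℚP.<⇒≤ (ℚP.≰⇒> (no-grid-below {k} k<ℓ))

  SameSides : ℚ → ℚ → ℚ → ℚ → Set
  SameSides a r a′ r′ = ∀ i → i ≤ℕ n → Integral i →
    (ℓ i ℚ.≤ lineAt a r i → ℓ i ℚ.≤ lineAt a′ r′ i) × (ℓ i ℚ.≤ lineAt a′ r′ i → ℓ i ℚ.≤ lineAt a r i)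

  wordOf-≡ : ∀ {a r a′ r′} → Admissible a r → Admissible a′ r′ → SameSides a r a′ r′ →
             wordOf n a r ≡ wordOf n a′ r′
  wordOf-≡ {a} {r} {a′} {r′} adm adm′ sides = wordOf-cong n {a} {r} {a′} {r′} floor≡
    where
    floor≡ : ∀ i → i ≤ℕ n → floor (lineAt a r i) ≡ floor (lineAt a′ r′ i)
    floor≡ i i≤n = cases (integral? i) (ℓ i ℚP.≤? lineAt a r i) (ℓ i ℚP.≤? lineAt a′ r′ i)
      where
      cases : Dec (Integral i) → Dec (ℓ i ℚ.≤ lineAt a r i) → Dec (ℓ i ℚ.≤ lineAt a′ r′ i) →
              floor (lineAt a r i) ≡ floor (lineAt a′ r′ i)
      cases (no ¬int) _ _ = trans (floor-nonIntegral adm i≤n ¬int) (sym (floor-nonIntegral adm′ i≤n ¬int))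
      cases (yes int) (yes ℓ≤) (yes ℓ≤′) = trans (floor-above adm i≤n ℓ≤) (sym (floor-above adm′ i≤n ℓ≤′))
      cases (yes int) (yes ℓ≤) (no  ℓ≰′) = ⊥-elim (ℓ≰′ (proj₁ (sides i i≤n int) ℓ≤))
      cases (yes int) (no  ℓ≰) (yes ℓ≤′) = ⊥-elim (ℓ≰ (proj₂ (sides i i≤n int) ℓ≤′))
      cases (yes int) (no  ℓ≰) (no  ℓ≰′) = sucℤ-injective
        (trans (floor-below-integral adm i≤n (ℚP.≰⇒> ℓ≰) int) (sym (floor-below-integral adm′ i≤n (ℚP.≰⇒> ℓ≰′) int)))

  wordOf-≢ : ∀ {a r a′ r′} → Admissible a r → Admissible a′ r′ → ∀ i → i ≤ℕ n → Integral i →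
             ℓ i ℚ.≤ lineAt a r i → lineAt a′ r′ i ℚ.< ℓ i → wordOf n a r ≢ wordOf n a′ r′
  wordOf-≢ {a} {r} {a′} {r′} adm adm′ i i≤n int above below w≡w′ = ℤP.i≢suc[i] (begin
    floor (lineAt a′ r′ i)         ≡⟨ sym (wordOf≡⇒floor≡ n {a} {r} {a′} {r′} floor₀≡ w≡w′ i i≤n) ⟩
    floor (lineAt a r i)           ≡⟨ floor-above adm i≤n above ⟩
    floor (ℓ i)                    ≡⟨ sym (floor-below-integral adm′ i≤n below int) ⟩
    ℤ.suc (floor (lineAt a′ r′ i)) ∎)
    where
    open ≡-Reasoning
    floor₀≡ : floor (lineAt a r 0) ≡ floor (lineAt a′ r′ 0)
    floor₀≡ = trans (floor-InS-0 (proj₁ adm)) (sym (floor-InS-0 (proj₁ adm′)))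

  -- Through its integer point i₀, ℓ takes values on the grid of mesh 1 / q (q the
  -- denominator of α), and η Δ stays within one mesh for |Δ| ≤ 2n + 1: the tilted
  -- lines below cross no grid point.
  module Tilt (1≤n : 1 ≤ℕ n) (i₀ : ℕ) (int₀ : Integral i₀) where

    open Grid (ℚ.denominator-1 α)
    module Fine = Grid (suc (n ℕ.+ n))

    η : ℚ
    η = mesh ℚ.* Fine.mesh

    0<η : 0ℚ ℚ.< η
    0<η = *-pos 0<mesh Fine.0<mesh

    ρ-onGrid : OnGrid ρ
    ρ-onGrid = subst OnGrid ρ≡ (OnGrid-+ (OnGrid-ℤ (floor (ℓ i₀))) (OnGrid-neg (OnGrid-*ℤ (+ i₀) (OnGrid-self α))))
      where
      ρ≡ : ℤ→ℚ (floor (ℓ i₀)) ℚ.+ ℚ.- (α ℚ.* ℕ→ℚ i₀) ≡ ρ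
      ρ≡ = trans (cong (ℚ._+ ℚ.- (α ℚ.* ℕ→ℚ i₀)) int₀)
        (ℚS.solve 3 (λ a x r → a ℚS.:* x ℚS.:+ r ℚS.:+ ℚS.:- (a ℚS.:* x) ℚS.:= r) refl α (ℕ→ℚ i₀) ρ)

    ℓ-onGrid : ∀ i → OnGrid (ℓ i)
    ℓ-onGrid i = OnGrid-+ (OnGrid-*ℤ (+ i) (OnGrid-self α)) ρ-onGrid

    Small : ℚ → Set
    Small x = (ℚ.- Fine.scale ℚ.< x) × (x ℚ.< Fine.scale)

    η*small : ∀ {x} → Small x → (ℚ.- mesh ℚ.< η ℚ.* x) × (η ℚ.* x ℚ.< mesh)
    η*small {x} (-D<x , x<D) =
      subst₂ ℚ._<_ (g*-1≡-g mesh) (sym (ℚP.*-assoc mesh Fine.mesh x)) (ℚP.*-monoʳ-<-pos mesh {{ℚ.positive 0<mesh}} -1<θx) ,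
      subst₂ ℚ._<_ (sym (ℚP.*-assoc mesh Fine.mesh x)) (ℚP.*-identityʳ mesh) (ℚP.*-monoʳ-<-pos mesh {{ℚ.positive 0<mesh}} θx<1)
      where
      instance
        θ-pos : ℚ.Positive Fine.mesh
        θ-pos = ℚ.positive Fine.0<mesh
      g*-1≡-g : ∀ g → g ℚ.* (ℚ.- 1ℚ) ≡ ℚ.- g
      g*-1≡-g g = trans (sym (ℚP.neg-distribʳ-* g 1ℚ)) (cong ℚ.-_ (ℚP.*-identityʳ g))
      θx<1 : Fine.mesh ℚ.* x ℚ.< 1ℚ
      θx<1 = subst (Fine.mesh ℚ.* x ℚ.<_) Fine.mesh*scale≡1 (ℚP.*-monoʳ-<-pos Fine.mesh x<D)
      -1<θx : ℚ.- 1ℚ ℚ.< Fine.mesh ℚ.* x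
      -1<θx = subst (ℚ._< Fine.mesh ℚ.* x)
        (trans (sym (ℚP.neg-distribʳ-* Fine.mesh Fine.scale)) (cong ℚ.-_ Fine.mesh*scale≡1))
        (ℚP.*-monoʳ-<-pos Fine.mesh -D<x)

    small-diff : ∀ {x y} → x ≤ℕ suc (n ℕ.+ n) → y ≤ℕ suc (n ℕ.+ n) → Small (ℕ→ℚ x ℚ.- ℕ→ℚ y)
    small-diff {x} {y} x≤ y≤ = lower , upper
      where
      upper : ℕ→ℚ x ℚ.- ℕ→ℚ y ℚ.< Fine.scale
      upper = ℚP.≤-<-trans (subst (ℕ→ℚ x ℚ.- ℕ→ℚ y ℚ.≤_) (ℚP.+-identityʳ (ℕ→ℚ x))
                              (ℚP.+-monoʳ-≤ (ℕ→ℚ x) (ℚP.neg-antimono-≤ (0≤ℕ→ℚ y))))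
                            (ℕ→ℚ-mono-< (s≤s x≤))
      lower : ℚ.- Fine.scale ℚ.< ℕ→ℚ x ℚ.- ℕ→ℚ y
      lower = ℚP.<-≤-trans (ℚP.neg-antimono-< (ℕ→ℚ-mono-< (s≤s y≤)))
                (subst (ℚ._≤ ℕ→ℚ x ℚ.- ℕ→ℚ y) (ℚP.+-identityˡ (ℚ.- ℕ→ℚ y)) (ℚP.+-monoˡ-≤ (ℚ.- ℕ→ℚ y) (0≤ℕ→ℚ x)))

    noGrid-near : ∀ {a r} (Δ : ℕ → ℚ) → (∀ i → lineAt a r i ≡ ℓ i ℚ.+ η ℚ.* Δ i) →
                  (∀ i → i ≤ℕ n → Small (Δ i)) → NoGridBetween n α ρ a r
    noGrid-near Δ line≡ small i j i≤n _ (inj₁ (ℓ<j , j≤ℓ′)) = <⇒≱ (proj₂ (η*small (small i i≤n)))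
      (+-cancelˡ-≤ (ℓ i) (ℚP.≤-trans (OnGrid-<⇒+mesh≤ (ℓ-onGrid i) (OnGrid-ℤ (+ j)) ℓ<j) (subst (ℕ→ℚ j ℚ.≤_) (line≡ i) j≤ℓ′)))
    noGrid-near {a} {r} Δ line≡ small i j i≤n _ (inj₂ (ℓ′≤j , j<ℓ)) = <⇒≱ 0<ηΔ+γ ηΔ+γ≤0
      where
      ηΔ = η ℚ.* Δ i
      0<ηΔ+γ : 0ℚ ℚ.< ηΔ ℚ.+ mesh
      0<ηΔ+γ = subst (ℚ._< ηΔ ℚ.+ mesh) (ℚP.+-inverseˡ mesh) (ℚP.+-monoˡ-< mesh (proj₁ (η*small (small i i≤n))))
      ηΔ+γ≤0 : ηΔ ℚ.+ mesh ℚ.≤ 0ℚ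
      ηΔ+γ≤0 = +-cancelˡ-≤ (ℓ i) (subst₂ ℚ._≤_ (ℚP.+-assoc (ℓ i) ηΔ mesh) (sym (ℚP.+-identityʳ (ℓ i)))
        (ℚP.≤-trans (ℚP.+-monoˡ-≤ mesh (subst (ℚ._≤ ℕ→ℚ j) (line≡ i) ℓ′≤j)) (OnGrid-<⇒+mesh≤ (OnGrid-ℤ (+ j)) (ℓ-onGrid i) j<ℓ)))

    down-α : ℚ
    down-α = α ℚ.- (η ℚ.+ η)

    down-ρ : ℕ → ℚ
    down-ρ t = ρ ℚ.+ η ℚ.* ℕ→ℚ (suc (t ℕ.+ t))

    up-α : ℚ
    up-α = α ℚ.+ (η ℚ.+ η)

    up-ρ : ℕ → ℚ
    up-ρ t = ρ ℚ.+ η ℚ.* (1ℚ ℚ.- ℕ→ℚ (t ℕ.+ t))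

    down-Δ up-Δ : ℕ → ℕ → ℚ
    down-Δ t i = ℕ→ℚ (suc (t ℕ.+ t)) ℚ.- ℕ→ℚ (i ℕ.+ i)
    up-Δ   t i = ℕ→ℚ (suc (i ℕ.+ i)) ℚ.- ℕ→ℚ (t ℕ.+ t)

    lineAt-down : ∀ t i → lineAt down-α (down-ρ t) i ≡ ℓ i ℚ.+ η ℚ.* down-Δ t i
    lineAt-down t i = trans (expand α ρ η (ℕ→ℚ (suc (t ℕ.+ t))) (ℕ→ℚ i))
      (cong (λ z → ℓ i ℚ.+ η ℚ.* (ℕ→ℚ (suc (t ℕ.+ t)) ℚ.- z)) (sym (ℕ→ℚ-homo-+ i i)))
      where
      expand : ∀ a r e c x → (a ℚ.- (e ℚ.+ e)) ℚ.* x ℚ.+ (r ℚ.+ e ℚ.* c) ≡ a ℚ.* x ℚ.+ r ℚ.+ e ℚ.* (c ℚ.- (x ℚ.+ x))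
      expand = ℚS.solve 5 (λ a r e c x → (a ℚS.:- (e ℚS.:+ e)) ℚS.:* x ℚS.:+ (r ℚS.:+ e ℚS.:* c)
                              ℚS.:= a ℚS.:* x ℚS.:+ r ℚS.:+ e ℚS.:* (c ℚS.:- (x ℚS.:+ x))) refl

    lineAt-up : ∀ t i → lineAt up-α (up-ρ t) i ≡ ℓ i ℚ.+ η ℚ.* up-Δ t i
    lineAt-up t i = trans (expand α ρ η (ℕ→ℚ (t ℕ.+ t)) (ℕ→ℚ i))
      (cong (λ z → ℓ i ℚ.+ η ℚ.* (z ℚ.- ℕ→ℚ (t ℕ.+ t))) (sym (trans (ℕ→ℚ-homo-+ 1 (i ℕ.+ i)) (cong (1ℚ ℚ.+_) (ℕ→ℚ-homo-+ i i)))))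
      where
      expand : ∀ a r e c x → (a ℚ.+ (e ℚ.+ e)) ℚ.* x ℚ.+ (r ℚ.+ e ℚ.* (1ℚ ℚ.- c)) ≡ a ℚ.* x ℚ.+ r ℚ.+ e ℚ.* ((1ℚ ℚ.+ (x ℚ.+ x)) ℚ.- c)
      expand = ℚS.solve 5 (λ a r e c x → (a ℚS.:+ (e ℚS.:+ e)) ℚS.:* x ℚS.:+ (r ℚS.:+ e ℚS.:* (ℚS.con 1ℚ ℚS.:- c))
                              ℚS.:= a ℚS.:* x ℚS.:+ r ℚS.:+ e ℚS.:* ((ℚS.con 1ℚ ℚS.:+ (x ℚS.:+ x)) ℚS.:- c)) refl

    private
      double≤ : ∀ {x} → x ≤ℕ n → suc (x ℕ.+ x) ≤ℕ suc (n ℕ.+ n)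
      double≤ x≤n = s≤s (ℕP.+-mono-≤ x≤n x≤n)

      0<ηΔ : ∀ {x y} → y <ℕ x → 0ℚ ℚ.< η ℚ.* (ℕ→ℚ x ℚ.- ℕ→ℚ y)
      0<ηΔ y<x = *-pos 0<η (<⇒0<- (ℕ→ℚ-mono-< y<x))

      ηΔ<0 : ∀ {x y} → x <ℕ y → η ℚ.* (ℕ→ℚ x ℚ.- ℕ→ℚ y) ℚ.< 0ℚ
      ηΔ<0 {x} {y} x<y = subst (η ℚ.* (ℕ→ℚ x ℚ.- ℕ→ℚ y) ℚ.<_) (ℚP.*-zeroʳ η)
        (ℚP.*-monoʳ-<-pos η {{ℚ.positive 0<η}} (<⇒-<0 (ℕ→ℚ-mono-< x<y)))

      2t+1<2i : ∀ {t i} → t <ℕ i → suc (t ℕ.+ t) <ℕ i ℕ.+ i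
      2t+1<2i {t} {i} t<i = subst (_≤ℕ i ℕ.+ i) (cong suc (ℕP.+-suc t t)) (ℕP.+-mono-≤ t<i t<i)

      2t<2i+1 : ∀ {t i} → t ≤ℕ i → t ℕ.+ t <ℕ suc (i ℕ.+ i)
      2t<2i+1 t≤i = s≤s (ℕP.+-mono-≤ t≤i t≤i)

    ℓ<down : ∀ t i → i ≤ℕ t → ℓ i ℚ.< lineAt down-α (down-ρ t) i
    ℓ<down t i i≤t = subst (ℓ i ℚ.<_) (sym (lineAt-down t i)) (x<x+p (ℓ i) (0<ηΔ (2t<2i+1 i≤t)))

    down<ℓ : ∀ t i → t <ℕ i → lineAt down-α (down-ρ t) i ℚ.< ℓ i
    down<ℓ t i t<i = subst (ℚ._< ℓ i) (sym (lineAt-down t i)) (x+p<x (ℓ i) (ηΔ<0 (2t+1<2i t<i)))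

    ℓ<up : ∀ t i → t ≤ℕ i → ℓ i ℚ.< lineAt up-α (up-ρ t) i
    ℓ<up t i t≤i = subst (ℓ i ℚ.<_) (sym (lineAt-up t i)) (x<x+p (ℓ i) (0<ηΔ (2t<2i+1 t≤i)))

    up<ℓ : ∀ t i → i <ℕ t → lineAt up-α (up-ρ t) i ℚ.< ℓ i
    up<ℓ t i i<t = subst (ℚ._< ℓ i) (sym (lineAt-up t i)) (x+p<x (ℓ i) (ηΔ<0 (2t+1<2i i<t)))

    2η<mesh : η ℚ.+ η ℚ.< mesh
    2η<mesh = subst (ℚ._< mesh) (η*2≡η+η η) (proj₂ (η*small (small-diff {2} {0} (s≤s (ℕP.≤-trans 1≤n (ℕP.m≤m+n n n))) z≤n)))
      where
      η*2≡η+η : ∀ e → e ℚ.* (ℕ→ℚ 2 ℚ.- ℕ→ℚ 0) ≡ e ℚ.+ e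
      η*2≡η+η e = ℚS.solve 1 (λ e → e ℚS.:* (ℚS.con (ℕ→ℚ 2) ℚS.:- ℚS.con 0ℚ) ℚS.:= e ℚS.:+ e) refl e

    ρ+mesh≤1 : ρ ℚ.< 1ℚ → ρ ℚ.+ mesh ℚ.≤ 1ℚ
    ρ+mesh≤1 = OnGrid-<⇒+mesh≤ ρ-onGrid (OnGrid-ℤ (+ 1))

    down-admissible : 0ℚ ℚ.< α → ρ ℚ.< 1ℚ → ∀ t → t ≤ℕ n → Admissible down-α (down-ρ t)
    down-admissible 0<α ρ<1 t t≤n = ((0<α′ , α′<1) , (0<ρ′ , ρ′<1)) ,
      noGrid-near {down-α} {down-ρ t} (down-Δ t) (lineAt-down t) (λ i i≤n → small-diff (double≤ t≤n) (ℕP.m≤n⇒m≤1+n (ℕP.+-mono-≤ i≤n i≤n)))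
      where
      0<α′ = <⇒0<- (ℚP.<-≤-trans 2η<mesh (OnGrid-pos⇒mesh≤ (OnGrid-self α) 0<α))
      α′<1 = ℚP.<-≤-trans (x+p<x α (ℚP.neg-antimono-< (ℚP.+-mono-< 0<η 0<η))) α≤1
      0<ρ′ = subst (ℚ._< down-ρ t) (ℚP.+-identityʳ 0ℚ) (ℚP.+-mono-≤-< 0≤ρ (*-pos 0<η (ℕ→ℚ-mono-< {0} {suc (t ℕ.+ t)} (s≤s z≤n))))
      ρ′<1 = ℚP.<-≤-trans (ℚP.+-monoʳ-< ρ (proj₂ (η*small (subst Small (ℚP.+-identityʳ _) (small-diff {y = 0} (double≤ t≤n) z≤n))))) (ρ+mesh≤1 ρ<1)

    up-admissible : α ℚ.< 1ℚ → ∀ t → t ≤ℕ n → (0ℚ ℚ.< ρ ⊎ t ≡ 0) → (ρ ℚ.< 1ℚ ⊎ 1 ≤ℕ t) → Admissible up-α (up-ρ t)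
    up-admissible α<1 t t≤n ρ-low ρ-high = ((0<α′ , α′<1) , (0<ρ′ ρ-low , ρ′<1 ρ-high)) ,
      noGrid-near {up-α} {up-ρ t} (up-Δ t) (lineAt-up t) (λ i i≤n → small-diff (double≤ i≤n) (ℕP.m≤n⇒m≤1+n (ℕP.+-mono-≤ t≤n t≤n)))
      where
      ηΔ-small = η*small (small-diff {1} {t ℕ.+ t} (s≤s z≤n) (ℕP.m≤n⇒m≤1+n (ℕP.+-mono-≤ t≤n t≤n)))
      0<α′ = subst (ℚ._< up-α) (ℚP.+-identityʳ 0ℚ) (ℚP.+-mono-≤-< 0≤α (ℚP.+-mono-< 0<η 0<η))
      α′<1 = ℚP.<-≤-trans (ℚP.+-monoʳ-< α 2η<mesh) (OnGrid-<⇒+mesh≤ (OnGrid-self α) (OnGrid-ℤ (+ 1)) α<1)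
      0<ρ′ : (0ℚ ℚ.< ρ ⊎ t ≡ 0) → 0ℚ ℚ.< up-ρ t
      0<ρ′ (inj₂ refl) = subst (ℚ._< up-ρ 0) (ℚP.+-identityʳ 0ℚ) (ℚP.+-mono-≤-< 0≤ρ (0<ηΔ {1} {0} (s≤s z≤n)))
      0<ρ′ (inj₁ 0<ρ)  = subst (ℚ._< up-ρ t) (ℚP.+-inverseʳ mesh) (ℚP.+-mono-≤-< (OnGrid-pos⇒mesh≤ ρ-onGrid 0<ρ) (proj₁ ηΔ-small))
      ρ′<1 : (ρ ℚ.< 1ℚ ⊎ 1 ≤ℕ t) → up-ρ t ℚ.< 1ℚ
      ρ′<1 (inj₁ ρ<1) = ℚP.<-≤-trans (ℚP.+-monoʳ-< ρ (proj₂ ηΔ-small)) (ρ+mesh≤1 ρ<1)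
      ρ′<1 (inj₂ 1≤t) = ℚP.<-≤-trans (x+p<x ρ (ηΔ<0 {1} {t ℕ.+ t} (ℕP.+-mono-≤ 1≤t 1≤t))) ρ≤1

  points lowPoints highPoints : List ℕ
  points     = filter integral? (upTo (suc n))
  lowPoints  = filter integral? (upTo (suc ⌊ n /2⌋))
  highPoints = filter integral? (applyUpTo (suc ⌊ n /2⌋ ℕ.+_) (n ∸ ⌊ n /2⌋))

  Zn≡low+high : Zn n α ρ ≡ length lowPoints ℕ.+ length highPoints
  Zn≡low+high = begin
    length points                                          ≡⟨ cong (length ∘ filter integral?) upTo-split ⟩
    length (filter integral? (upTo (suc ⌊ n /2⌋) ++ high))  ≡⟨ cong length (LP.filter-++ integral? (upTo (suc ⌊ n /2⌋)) high) ⟩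
    length (lowPoints ++ highPoints)                       ≡⟨ LP.length-++ lowPoints ⟩
    length lowPoints ℕ.+ length highPoints                 ∎
    where
    open ≡-Reasoning
    high = applyUpTo (suc ⌊ n /2⌋ ℕ.+_) (n ∸ ⌊ n /2⌋)
    upTo-split : upTo (suc n) ≡ upTo (suc ⌊ n /2⌋) ++ high
    upTo-split = trans (cong (upTo ∘ suc) (sym (ℕP.m+[n∸m]≡n (ℕP.⌊n/2⌋≤n n))))
                       (applyUpTo-+ (λ x → x) (suc ⌊ n /2⌋) (n ∸ ⌊ n /2⌋))

  points-sorted : Sorted points
  points-sorted = AllPairsP.filter⁺ integral? (AllPairsP.applyUpTo⁺₁ (λ x → x) (suc n) (λ i<j _ → i<j))

  lowPoints-sorted : Sorted lowPoints
  lowPoints-sorted = AllPairsP.filter⁺ integral? (AllPairsP.applyUpTo⁺₁ (λ x → x) (suc ⌊ n /2⌋) (λ i<j _ → i<j))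

  highPoints-sorted : Sorted highPoints
  highPoints-sorted = AllPairsP.filter⁺ integral?
    (AllPairsP.applyUpTo⁺₁ (suc ⌊ n /2⌋ ℕ.+_) (n ∸ ⌊ n /2⌋) (λ i<j _ → ℕP.+-monoʳ-< (suc ⌊ n /2⌋) i<j))

  ∈points⁻ : ∀ {t} → t ∈ points → Integral t × t ≤ℕ n
  ∈points⁻ t∈ = let t∈upTo , int = MP.∈-filter⁻ integral? t∈ in int , ℕP.≤-pred (MP.∈-upTo⁻ t∈upTo)

  ∈lowPoints⁻ : ∀ {t} → t ∈ lowPoints → Integral t × 2 ℕ.* t ≤ℕ n
  ∈lowPoints⁻ t∈ = let t∈upTo , int = MP.∈-filter⁻ integral? t∈ in
    int , t≤⌊n/2⌋⇒2*t≤n (ℕP.≤-pred (MP.∈-upTo⁻ t∈upTo))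

  ∈lowPoints⁺ : ∀ {t} → Integral t → 2 ℕ.* t ≤ℕ n → t ∈ lowPoints
  ∈lowPoints⁺ int 2t≤n = MP.∈-filter⁺ integral? (MP.∈-upTo⁺ (s≤s (2*t≤n⇒t≤⌊n/2⌋ 2t≤n))) int

  ∈lowPoints⇒≤n : ∀ {t} → t ∈ lowPoints → t ≤ℕ n
  ∈lowPoints⇒≤n t∈ = ℕP.≤-trans (ℕP.m≤m+n _ _) (proj₂ (∈lowPoints⁻ t∈))

  ∈highPoints⁻ : ∀ {t} → t ∈ highPoints → Integral t × n <ℕ 2 ℕ.* t × t ≤ℕ n
  ∈highPoints⁻ {t} t∈ = int , ⌊n/2⌋<t⇒n<2*t n/2<t , t≤n
    where
    high = applyUpTo (suc ⌊ n /2⌋ ℕ.+_) (n ∸ ⌊ n /2⌋)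
    t∈high = proj₁ (MP.∈-filter⁻ integral? {xs = high} t∈)
    int = proj₂ (MP.∈-filter⁻ integral? {xs = high} t∈)
    k = proj₁ (MP.∈-applyUpTo⁻ (suc ⌊ n /2⌋ ℕ.+_) t∈high)
    k<n-n/2 = proj₁ (proj₂ (MP.∈-applyUpTo⁻ (suc ⌊ n /2⌋ ℕ.+_) t∈high))
    t≡ = proj₂ (proj₂ (MP.∈-applyUpTo⁻ (suc ⌊ n /2⌋ ℕ.+_) t∈high))
    n/2<t : ⌊ n /2⌋ <ℕ t
    n/2<t = subst (⌊ n /2⌋ <ℕ_) (sym t≡) (s≤s (ℕP.m≤m+n ⌊ n /2⌋ k))
    t≤n : t ≤ℕ n
    t≤n = subst (_≤ℕ n) (sym t≡)
      (subst (suc ⌊ n /2⌋ ℕ.+ k ≤ℕ_) (ℕP.m+[n∸m]≡n (ℕP.⌊n/2⌋≤n n)) (ℕP.+-monoʳ-< ⌊ n /2⌋ k<n-n/2))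

  ∈highPoints⁺ : ∀ {t} → Integral t → n <ℕ 2 ℕ.* t → t ≤ℕ n → t ∈ highPoints
  ∈highPoints⁺ {t} int n<2t t≤n = MP.∈-filter⁺ integral?
    (subst (_∈ applyUpTo (suc ⌊ n /2⌋ ℕ.+_) (n ∸ ⌊ n /2⌋)) (ℕP.m+[n∸m]≡n n/2<t)
      (MP.∈-applyUpTo⁺ (suc ⌊ n /2⌋ ℕ.+_) (ℕP.≤-<-trans (ℕP.∸-monoˡ-≤ (suc ⌊ n /2⌋) t≤n)
        (ℕP.∸-monoʳ-< (ℕP.n<1+n ⌊ n /2⌋) (ℕP.<-≤-trans n/2<t t≤n))))) int
    where
    n/2<t = n<2*t⇒⌊n/2⌋<t n<2t

  low<high : ∀ {t s} → t ∈ lowPoints → s ∈ highPoints → t <ℕ s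
  low<high t∈ s∈ = ℕP.≤-<-trans (2*t≤n⇒t≤⌊n/2⌋ (proj₂ (∈lowPoints⁻ t∈))) (n<2*t⇒⌊n/2⌋<t (proj₁ (proj₂ (∈highPoints⁻ s∈))))

  -- Were it not so, reflecting another integer point through the first (last) one
  -- would give an earlier (later) one.
  first-low : ∀ {m q} → Integral m → (∀ k → k <ℕ m → ¬ Integral k) →
              Integral q → m <ℕ q → q ≤ℕ n → 2 ℕ.* m ≤ℕ n
  first-low {m} {q} int-m first int-q m<q q≤n = ℕP.≮⇒≥ λ n<2m →
    let r+q≡2m = ℕP.m∸n+n≡m (ℕP.≤-trans q≤n (ℕP.<⇒≤ (subst (n <ℕ_) (2*x≡x+x m) n<2m)))
    in first ((m ℕ.+ m) ∸ q) (ℕP.+-cancelʳ-< q _ m (subst (_<ℕ m ℕ.+ q) (sym r+q≡2m) (ℕP.+-monoʳ-< m m<q)))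
             (integral-reflect α ρ {q} {m} int-q int-m r+q≡2m)

  last-high : ∀ {M p} → Integral M → (∀ k → M <ℕ k → k ≤ℕ n → ¬ Integral k) →
              Integral p → p <ℕ M → n <ℕ 2 ℕ.* M
  last-high {M} {p} int-M last int-p p<M = ℕP.≰⇒> λ 2M≤n →
    let r+p≡2M = ℕP.m∸n+n≡m (ℕP.≤-trans (ℕP.<⇒≤ p<M) (ℕP.m≤m+n M M))
    in last ((M ℕ.+ M) ∸ p) (ℕP.+-cancelʳ-< p M _ (subst (M ℕ.+ p <ℕ_) (sym r+p≡2M) (ℕP.+-monoʳ-< M p<M)))
            (ℕP.≤-trans (ℕP.m∸n≤m (M ℕ.+ M) p) (subst (_≤ℕ n) (2*x≡x+x M) 2M≤n))
            (integral-reflect α ρ {p} {M} int-p int-M r+p≡2M)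

  module Extremes (2≤Zn : 2 ≤ℕ Zn n α ρ) where

    private
      p q : ℕ
      p = proj₁ (two-members points-sorted 2≤Zn)
      q = proj₁ (proj₂ (two-members points-sorted 2≤Zn))
      p∈ = proj₁ (proj₂ (proj₂ (two-members points-sorted 2≤Zn)))
      q∈ = proj₁ (proj₂ (proj₂ (proj₂ (two-members points-sorted 2≤Zn))))
      p<q = proj₂ (proj₂ (proj₂ (proj₂ (two-members points-sorted 2≤Zn))))
      int-p = proj₁ (∈points⁻ p∈)
      int-q = proj₁ (∈points⁻ q∈)
      q≤n = proj₂ (∈points⁻ q∈)
      first = BoundedSearch.least integral? p int-p
      last = BoundedSearch.greatest integral? n q int-q q≤n

    m : ℕ
    m = proj₁ first

    int-m : Integral m
    int-m = proj₁ (proj₂ first)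

    m∈low : m ∈ lowPoints
    m∈low = ∈lowPoints⁺ int-m
      (first-low int-m (proj₂ (proj₂ (proj₂ first))) int-q (ℕP.≤-<-trans (proj₁ (proj₂ (proj₂ first))) p<q) q≤n)

    M : ℕ
    M = proj₁ last

    int-M : Integral M
    int-M = proj₁ (proj₂ last)

    M-last : ∀ k → M <ℕ k → k ≤ℕ n → ¬ Integral k
    M-last = proj₂ (proj₂ (proj₂ (proj₂ last)))

    M∈high : M ∈ highPoints
    M∈high = ∈highPoints⁺ int-M
      (last-high int-M M-last int-p (ℕP.<-≤-trans p<q (proj₁ (proj₂ (proj₂ last)))))
      (proj₁ (proj₂ (proj₂ (proj₂ last))))

  record Witness (w : Vec ℤ n) : Set where
    field
      a r        : ℚ
      admissible : Admissible a r
      word≡      : wordOf n a r ≡ w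
      i₁         : ℕ
      int₁       : Integral i₁
      2i₁≤n      : 2 ℕ.* i₁ ≤ℕ n
      ℓ<ℓ′₁      : ℓ i₁ ℚ.< lineAt a r i₁
      i₂         : ℕ
      int₂       : Integral i₂
      n<2i₂      : n <ℕ 2 ℕ.* i₂
      i₂≤n       : i₂ ≤ℕ n
      ℓ<ℓ′₂      : ℓ i₂ ℚ.< lineAt a r i₂

  witness : ∀ {w} → InM n α ρ w → Witness w
  witness (a , r , inS , word≡ , noGrid , (i₁ , j₁ , i₂ , j₂ , on₁ , on₂ , 2i₁≤n , n<2i₂ , i₂≤n , j₁< , j₂<)) = record
    { a = a ; r = r ; admissible = inS , noGrid ; word≡ = word≡
    ; i₁ = i₁ ; int₁ = onLine⇒integral {i₁} {j₁} on₁ ; 2i₁≤n = 2i₁≤n ; ℓ<ℓ′₁ = subst (ℚ._< lineAt a r i₁) (sym on₁) j₁<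
    ; i₂ = i₂ ; int₂ = onLine⇒integral {i₂} {j₂} on₂ ; n<2i₂ = n<2i₂ ; i₂≤n = i₂≤n ; ℓ<ℓ′₂ = subst (ℚ._< lineAt a r i₂) (sym on₂) j₂< }

  ¬Witness-below : ∀ {w} → (u : Witness w) → Witness.a u ℚ.≤ α → ¬ (Witness.r u ℚ.< ρ)
  ¬Witness-below u a≤α r<ρ = <⇒≱ ℓ<ℓ′₁ (ℚP.<⇒≤ (lineAt-mono-≤-< a≤α r<ρ i₁))
    where open Witness u

  size-α≡1-ρ≡1 : α ≡ 1ℚ → ρ ≡ 1ℚ → HasSize (InM n α ρ) 0
  size-α≡1-ρ≡1 α≡1 ρ≡1 = HasSize-intro [] [] refl (λ ()) λ w∈m →
    let u = witness w∈m
        open Witness u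
    in ⊥-elim (¬Witness-below u (subst (a ℚ.≤_) (sym α≡1) (ℚP.<⇒≤ (slope<1 admissible)))
                                (subst (r ℚ.<_) (sym ρ≡1) (intercept<1 admissible)))

  module Classification (1≤n : 1 ≤ℕ n) (2≤Zn : 2 ≤ℕ Zn n α ρ) where

    open Extremes 2≤Zn public
    open Tilt 1≤n m int-m public

    downWord upWord : ℕ → Vec ℤ n
    downWord t = wordOf n down-α (down-ρ t)
    upWord   t = wordOf n up-α (up-ρ t)

    -- The upward tilt through the first low point passes above every integer point,
    -- so its word is already the downward tilt through M.
    downWords innerUpWords : List (Vec ℤ n)
    downWords    = map downWord highPoints
    innerUpWords = map upWord (drop 1 lowPoints)

    downWord-≢ : ∀ {s t} → Admissible down-α (down-ρ s) → Admissible down-α (down-ρ t) →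
                 Integral t → t ≤ℕ n → s <ℕ t → downWord s ≢ downWord t
    downWord-≢ {s} {t} adm-s adm-t int-t t≤n s<t eq =
      wordOf-≢ adm-t adm-s t t≤n int-t (ℚP.<⇒≤ (ℓ<down t t ℕP.≤-refl)) (down<ℓ s t s<t) (sym eq)

    upWord-≢ : ∀ {s t} → Admissible up-α (up-ρ s) → Admissible up-α (up-ρ t) →
               Integral s → s ≤ℕ n → s <ℕ t → upWord s ≢ upWord t
    upWord-≢ {s} {t} adm-s adm-t int-s s≤n s<t =
      wordOf-≢ adm-s adm-t s s≤n int-s (ℚP.<⇒≤ (ℓ<up s s ℕP.≤-refl)) (up<ℓ t s s<t)

    upWord-≢-downWord : ∀ {t s y} → Admissible up-α (up-ρ t) → Admissible down-α (down-ρ s) →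
                        Integral y → y ≤ℕ n → y <ℕ t → y ≤ℕ s → upWord t ≢ downWord s
    upWord-≢-downWord {t} {s} {y} adm-t adm-s int-y y≤n y<t y≤s eq =
      wordOf-≢ adm-s adm-t y y≤n int-y (ℚP.<⇒≤ (ℓ<down s y y≤s)) (up<ℓ t y y<t) (sym eq)

    downWord∈m : 0ℚ ℚ.< α → ρ ℚ.< 1ℚ → ∀ {t} → t ∈ highPoints → InM n α ρ (downWord t)
    downWord∈m 0<α ρ<1 {t} t∈ = down-α , down-ρ t , proj₁ adm , refl , proj₂ adm ,
      (m , floor (ℓ m) , t , floor (ℓ t) , sym int-m , sym int-t , 2m≤n , n<2t , t≤n ,
       subst (ℚ._< lineAt down-α (down-ρ t) m) (sym int-m) (ℓ<down t m m≤t) ,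
       subst (ℚ._< lineAt down-α (down-ρ t) t) (sym int-t) (ℓ<down t t ℕP.≤-refl))
      where
      int-t = proj₁ (∈highPoints⁻ t∈)
      n<2t  = proj₁ (proj₂ (∈highPoints⁻ t∈))
      t≤n   = proj₂ (proj₂ (∈highPoints⁻ t∈))
      2m≤n  = proj₂ (∈lowPoints⁻ m∈low)
      m≤t   = ℕP.<⇒≤ (low<high m∈low t∈)
      adm   = down-admissible 0<α ρ<1 t t≤n

    upWord∈m : α ℚ.< 1ℚ → ∀ {t} → t ∈ lowPoints → Admissible up-α (up-ρ t) → InM n α ρ (upWord t)
    upWord∈m α<1 {t} t∈ adm = up-α , up-ρ t , proj₁ adm , refl , proj₂ adm ,
      (t , floor (ℓ t) , M , floor (ℓ M) , sym int-t , sym int-M , 2t≤n , n<2M , M≤n ,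
       subst (ℚ._< lineAt up-α (up-ρ t) t) (sym int-t) (ℓ<up t t ℕP.≤-refl) ,
       subst (ℚ._< lineAt up-α (up-ρ t) M) (sym int-M) (ℓ<up t M t≤M))
      where
      int-t = proj₁ (∈lowPoints⁻ t∈)
      2t≤n  = proj₂ (∈lowPoints⁻ t∈)
      n<2M  = proj₁ (proj₂ (∈highPoints⁻ M∈high))
      M≤n   = proj₂ (proj₂ (∈highPoints⁻ M∈high))
      t≤M   = ℕP.<⇒≤ (low<high t∈ M∈high)

    AboveAt : ℚ → ℚ → ℕ → Set
    AboveAt a r i = Integral i × ℓ i ℚ.≤ lineAt a r i

    aboveAt? : ∀ a r i → Dec (AboveAt a r i)
    aboveAt? a r i = integral? i ×-dec ℓ i ℚP.≤? lineAt a r i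

    -- A line of slope at most α passes above an initial segment of the integer points.
    shallow⇒∈downWords : 0ℚ ℚ.< α → ρ ℚ.< 1ℚ → ∀ {w} (u : Witness w) → Witness.a u ℚ.≤ α → w ∈ downWords
    shallow⇒∈downWords 0<α ρ<1 {w} u a≤α = subst (_∈ downWords) w≡
      (MP.∈-map⁺ downWord (∈highPoints⁺ (proj₁ above-t) (ℕP.<-≤-trans n<2i₂ (ℕP.*-monoʳ-≤ 2 i₂≤t)) t≤n))
      where
      open Witness u
      last = BoundedSearch.greatest (aboveAt? a r) n i₂ (int₂ , ℚP.<⇒≤ ℓ<ℓ′₂) i₂≤n
      t = proj₁ last
      above-t = proj₁ (proj₂ last)
      i₂≤t = proj₁ (proj₂ (proj₂ last))
      t≤n = proj₁ (proj₂ (proj₂ (proj₂ last)))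
      t-last = proj₂ (proj₂ (proj₂ (proj₂ last)))
      sides : SameSides a r down-α (down-ρ t)
      sides i i≤n int =
        (λ ℓ≤ℓ′ → ℚP.<⇒≤ (ℓ<down t i (ℕP.≮⇒≥ λ t<i → t-last i t<i i≤n (int , ℓ≤ℓ′)))) ,
        (λ ℓ≤down → lineAt-≤-leftward a≤α (ℕP.≮⇒≥ λ t<i → <⇒≱ (down<ℓ t i t<i) ℓ≤down) (proj₂ above-t))
      w≡ : downWord t ≡ w
      w≡ = trans (sym (wordOf-≡ admissible (down-admissible 0<α ρ<1 t t≤n) sides)) word≡

    steep⇒upWord : ∀ {w} (u : Witness w) → α ℚ.≤ Witness.a u →
                  (∀ t → t ≤ℕ n → ℓ t ℚ.≤ lineAt (Witness.a u) (Witness.r u) t → Admissible up-α (up-ρ t)) →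
                  Σ[ t ∈ ℕ ] t ∈ lowPoints × ℓ t ℚ.≤ lineAt (Witness.a u) (Witness.r u) t × w ≡ upWord t
    steep⇒upWord u α≤a up-admissible′ =
      t , ∈lowPoints⁺ (proj₁ above-t) (ℕP.≤-trans (ℕP.*-monoʳ-≤ 2 t≤i₁) 2i₁≤n) , proj₂ above-t ,
      trans (sym word≡) (wordOf-≡ admissible (up-admissible′ t t≤n (proj₂ above-t)) sides)
      where
      open Witness u
      first = BoundedSearch.least (aboveAt? a r) i₁ (int₁ , ℚP.<⇒≤ ℓ<ℓ′₁)
      t = proj₁ first
      above-t = proj₁ (proj₂ first)
      t≤i₁ = proj₁ (proj₂ (proj₂ first))
      t-first = proj₂ (proj₂ (proj₂ first))
      t≤n = ℕP.≤-trans t≤i₁ (ℕP.≤-trans (ℕP.m≤m+n i₁ _) 2i₁≤n)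
      sides : SameSides a r up-α (up-ρ t)
      sides i i≤n int =
        (λ ℓ≤ℓ′ → ℚP.<⇒≤ (ℓ<up t i (ℕP.≮⇒≥ λ i<t → t-first i i<t (int , ℓ≤ℓ′)))) ,
        (λ ℓ≤up → lineAt-≤-rightward α≤a (ℕP.≮⇒≥ λ i<t → <⇒≱ (up<ℓ t i i<t) ℓ≤up) (proj₂ above-t))

    above-all⇒downWord-M : ∀ {a r} → 0ℚ ℚ.< α → ρ ℚ.< 1ℚ → Admissible a r →
                           (∀ i → i ≤ℕ n → Integral i → ℓ i ℚ.≤ lineAt a r i) → wordOf n a r ≡ downWord M
    above-all⇒downWord-M 0<α ρ<1 adm above = wordOf-≡ adm (down-admissible 0<α ρ<1 M M≤n) λ i i≤n int →
      (λ _ → ℚP.<⇒≤ (ℓ<down M i (ℕP.≮⇒≥ λ M<i → M-last i M<i i≤n int))) , (λ _ → above i i≤n int)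
      where M≤n = proj₂ (proj₂ (∈highPoints⁻ M∈high))

    above-all⇒upWord-0 : ∀ {a r} → α ℚ.< 1ℚ → ρ ℚ.< 1ℚ → Admissible a r →
                         (∀ i → i ≤ℕ n → Integral i → ℓ i ℚ.≤ lineAt a r i) → wordOf n a r ≡ upWord 0
    above-all⇒upWord-0 α<1 ρ<1 adm above = wordOf-≡ adm (up-admissible α<1 0 z≤n (inj₂ refl) (inj₁ ρ<1)) λ i i≤n int →
      (λ _ → ℚP.<⇒≤ (ℓ<up 0 i z≤n)) , (λ _ → above i i≤n int)

    downWords-unique : 0ℚ ℚ.< α → ρ ℚ.< 1ℚ → Unique downWords
    downWords-unique 0<α ρ<1 = map-unique downWord highPoints-sorted λ s∈ t∈ s<t →
      downWord-≢ (adm s∈) (adm t∈) (proj₁ (∈highPoints⁻ t∈)) (proj₂ (proj₂ (∈highPoints⁻ t∈))) s<t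
      where
      adm : ∀ {t} → t ∈ highPoints → Admissible down-α (down-ρ t)
      adm {t} t∈ = down-admissible 0<α ρ<1 t (proj₂ (proj₂ (∈highPoints⁻ t∈)))

    upWords-unique : ∀ {xs} → Sorted xs → (∀ {t} → t ∈ xs → t ∈ lowPoints × Admissible up-α (up-ρ t)) →
                     Unique (map upWord xs)
    upWords-unique sorted adm = map-unique upWord sorted λ s∈ t∈ s<t →
      upWord-≢ (proj₂ (adm s∈)) (proj₂ (adm t∈)) (proj₁ (∈lowPoints⁻ (proj₁ (adm s∈)))) (∈lowPoints⇒≤n (proj₁ (adm s∈))) s<t

    innerUpWords-unique : (∀ {t} → t ∈ drop 1 lowPoints → Admissible up-α (up-ρ t)) → Unique innerUpWords
    innerUpWords-unique up-adm = upWords-unique (AllPairsP.drop⁺ 1 lowPoints-sorted) λ t∈ → drop1⊆ t∈ , up-adm t∈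

    innerUpWords-disjoint-downWords : 0ℚ ℚ.< α → ρ ℚ.< 1ℚ → (∀ {t} → t ∈ drop 1 lowPoints → Admissible up-α (up-ρ t)) →
                                      All (λ x → All (x ≢_) downWords) innerUpWords
    innerUpWords-disjoint-downWords 0<α ρ<1 up-adm = AllP.map⁺ (All.tabulate λ t∈ → AllP.map⁺ (All.tabulate λ s∈ →
      let y , y∈ , y<t = ∈-drop1⇒head< lowPoints-sorted t∈ in
      upWord-≢-downWord (up-adm t∈) (down-admissible 0<α ρ<1 _ (proj₂ (proj₂ (∈highPoints⁻ s∈))))
        (proj₁ (∈lowPoints⁻ y∈)) (∈lowPoints⇒≤n y∈) y<t (ℕP.<⇒≤ (low<high y∈ s∈))))

    steeper⇒above : ∀ {a r} → α ℚ.≤ a → ρ ℚ.< r → ∀ i → i ≤ℕ n → Integral i → ℓ i ℚ.≤ lineAt a r i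
    steeper⇒above α≤a ρ<r i _ _ = ℚP.<⇒≤ (lineAt-mono-≤-< α≤a ρ<r i)

    above-all⇒∈downWords : 0ℚ ℚ.< α → ρ ℚ.< 1ℚ → ∀ {w} (u : Witness w) →
      (∀ i → i ≤ℕ n → Integral i → ℓ i ℚ.≤ lineAt (Witness.a u) (Witness.r u) i) → w ∈ downWords
    above-all⇒∈downWords 0<α ρ<1 u above = subst (_∈ downWords)
      (trans (sym (above-all⇒downWord-M 0<α ρ<1 admissible above)) word≡) (MP.∈-map⁺ downWord M∈high)
      where open Witness u

    -- A steeper line passes above a final segment of the integer points; if that is all
    -- of them, its word is the downward tilt through M rather than an upward one.
    steep⇒∈innerUpWords⊎above-all : ∀ {w} (u : Witness w) → α ℚ.≤ Witness.a u →
      (∀ t → t ≤ℕ n → ℓ t ℚ.≤ lineAt (Witness.a u) (Witness.r u) t → Admissible up-α (up-ρ t)) →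
      w ∈ innerUpWords ⊎ (∀ i → i ≤ℕ n → Integral i → ℓ i ℚ.≤ lineAt (Witness.a u) (Witness.r u) i)
    steep⇒∈innerUpWords⊎above-all {w} u α≤a up-adm =
      [ inj₁ ∘ in-inner , inj₂ ∘ above-all ]′ (∈-drop1⊎minimum lowPoints-sorted t∈)
      where
      open Witness u
      up = steep⇒upWord u α≤a up-adm
      t : ℕ
      t = proj₁ up
      t∈ : t ∈ lowPoints
      t∈ = proj₁ (proj₂ up)
      above-t : ℓ t ℚ.≤ lineAt a r t
      above-t = proj₁ (proj₂ (proj₂ up))
      in-inner : t ∈ drop 1 lowPoints → w ∈ innerUpWords
      in-inner t∈drop = subst (_∈ innerUpWords) (sym (proj₂ (proj₂ (proj₂ up)))) (MP.∈-map⁺ upWord t∈drop)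
      above-all : (∀ {x} → x ∈ lowPoints → t ≤ℕ x) → ∀ i → i ≤ℕ n → Integral i → ℓ i ℚ.≤ lineAt a r i
      above-all t-first i i≤n int = lineAt-≤-rightward α≤a t≤i above-t
        where
        t≤i : t ≤ℕ i
        t≤i = [ (λ 2i≤n → t-first (∈lowPoints⁺ int 2i≤n))
              , (λ n<2i → ℕP.<⇒≤ (low<high t∈ (∈highPoints⁺ int n<2i i≤n))) ]′
              (ℕP.≤-<-connex (2 ℕ.* i) n)

    size-α≡0-ρ≡0 : α ≡ 0ℚ → ρ ≡ 0ℚ → HasSize (InM n α ρ) 1
    size-α≡0-ρ≡0 α≡0 ρ≡0 = HasSize-intro (upWord 0 ∷ []) ([] ∷ []) refl
      (λ { (here refl) → upWord∈m α<1 0∈low (up-admissible α<1 0 z≤n (inj₂ refl) (inj₁ ρ<1)) })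
      (λ w∈m → here (complete (witness w∈m)))
      where
      α<1 = subst (ℚ._< 1ℚ) (sym α≡0) 0<1
      ρ<1 = subst (ℚ._< 1ℚ) (sym ρ≡0) 0<1
      0∈low : 0 ∈ lowPoints
      0∈low = ∈lowPoints⁺ (onLine⇒integral {0} {+ 0} (trans (lineAt-0 α ρ) ρ≡0)) z≤n
      complete : ∀ {w} → Witness w → w ≡ upWord 0
      complete u = trans (sym word≡) (above-all⇒upWord-0 α<1 ρ<1 admissible (steeper⇒above
        (subst (ℚ._≤ a) (sym α≡0) (ℚP.<⇒≤ (0<slope admissible))) (subst (ℚ._< r) (sym ρ≡0) (0<intercept admissible))))
        where open Witness u

    size-ρ≡0 : ρ ≡ 0ℚ → 0ℚ ℚ.< α → HasSize (InM n α ρ) (Zn n α ρ ∸ Zhalf n α ρ)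
    size-ρ≡0 ρ≡0 0<α = HasSize-intro downWords (downWords-unique 0<α ρ<1) length-downWords
      (∈-map⇒ downWord (downWord∈m 0<α ρ<1)) (complete ∘ witness)
      where
      ρ<1 = subst (ℚ._< 1ℚ) (sym ρ≡0) 0<1
      length-downWords : length downWords ≡ Zn n α ρ ∸ Zhalf n α ρ
      length-downWords = trans (LP.length-map downWord highPoints)
        (sym (trans (cong (_∸ length lowPoints) Zn≡low+high) (ℕP.m+n∸m≡n (length lowPoints) (length highPoints))))
      complete : ∀ {w} → Witness w → w ∈ downWords
      complete u = [ shallow⇒∈downWords 0<α ρ<1 u
                   , (λ α<a → above-all⇒∈downWords 0<α ρ<1 u
                       (steeper⇒above (ℚP.<⇒≤ α<a) (subst (ℚ._< r) (sym ρ≡0) (0<intercept admissible)))) ]′ (≤⊎> a α)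
        where open Witness u

    size-interior : 0ℚ ℚ.< α → α ℚ.< 1ℚ → 0ℚ ℚ.< ρ → ρ ℚ.< 1ℚ → HasSize (InM n α ρ) (Zn n α ρ ∸ 1)
    size-interior 0<α α<1 0<ρ ρ<1 = HasSize-intro (innerUpWords ++ downWords)
      (AllPairsP.++⁺ (innerUpWords-unique (up-adm ∘ drop1⊆)) (downWords-unique 0<α ρ<1)
                     (innerUpWords-disjoint-downWords 0<α ρ<1 (up-adm ∘ drop1⊆)))
      length≡ sound (complete ∘ witness)
      where
      up-adm : ∀ {t} → t ∈ lowPoints → Admissible up-α (up-ρ t)
      up-adm {t} t∈ = up-admissible α<1 t (∈lowPoints⇒≤n t∈) (inj₁ 0<ρ) (inj₁ ρ<1)
      length≡ : length (innerUpWords ++ downWords) ≡ Zn n α ρ ∸ 1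
      length≡ = begin
        length (innerUpWords ++ downWords)            ≡⟨ LP.length-++ innerUpWords ⟩
        length innerUpWords ℕ.+ length downWords      ≡⟨ cong₂ ℕ._+_ (trans (LP.length-map upWord (drop 1 lowPoints)) (LP.length-drop 1 lowPoints))
                                                                      (LP.length-map downWord highPoints) ⟩
        (length lowPoints ∸ 1) ℕ.+ length highPoints  ≡⟨ ℕP.+-∸-comm (length highPoints) (1≤length m∈low) ⟨
        length lowPoints ℕ.+ length highPoints ∸ 1     ≡⟨ cong (_∸ 1) Zn≡low+high ⟨
        Zn n α ρ ∸ 1                                  ∎
        where
        open ≡-Reasoning
        1≤length : ∀ {x} {xs : List ℕ} → x ∈ xs → 1 ≤ℕ length xs
        1≤length {xs = _ ∷ _} _ = s≤s z≤n
      sound : ∀ {w} → w ∈ innerUpWords ++ downWords → InM n α ρ w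
      sound w∈ = [ ∈-map⇒ upWord (λ t∈ → upWord∈m α<1 (drop1⊆ t∈) (up-adm (drop1⊆ t∈)))
                 , ∈-map⇒ downWord (downWord∈m 0<α ρ<1) ]′ (MP.∈-++⁻ innerUpWords w∈)
      complete : ∀ {w} → Witness w → w ∈ innerUpWords ++ downWords
      complete u = [ MP.∈-++⁺ʳ innerUpWords ∘ shallow⇒∈downWords 0<α ρ<1 u
                   , (λ α<a → [ MP.∈-++⁺ˡ , MP.∈-++⁺ʳ innerUpWords ∘ above-all⇒∈downWords 0<α ρ<1 u ]′
                       (steep⇒∈innerUpWords⊎above-all u (ℚP.<⇒≤ α<a)
                         (λ t t≤n _ → up-admissible α<1 t t≤n (inj₁ 0<ρ) (inj₁ ρ<1)))) ]′ (≤⊎> a α)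
        where open Witness u

    size-ρ≡1 : ρ ≡ 1ℚ → α ℚ.< 1ℚ → HasSize (InM n α ρ) (Zhalf n α ρ ∸ 1)
    size-ρ≡1 ρ≡1 α<1 = HasSize-intro innerUpWords (innerUpWords-unique up-adm)
      (trans (LP.length-map upWord (drop 1 lowPoints)) (LP.length-drop 1 lowPoints))
      (∈-map⇒ upWord λ t∈ → upWord∈m α<1 (drop1⊆ t∈) (up-adm t∈)) (complete ∘ witness)
      where
      0<ρ = subst (0ℚ ℚ.<_) (sym ρ≡1) 0<1
      0∈low : 0 ∈ lowPoints
      0∈low = ∈lowPoints⁺ (onLine⇒integral {0} {+ 1} (trans (lineAt-0 α ρ) ρ≡1)) z≤n
      up-adm : ∀ {t} → t ∈ drop 1 lowPoints → Admissible up-α (up-ρ t)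
      up-adm {t} t∈ = up-admissible α<1 t (∈lowPoints⇒≤n (drop1⊆ t∈)) (inj₁ 0<ρ)
        (inj₂ (ℕP.≤-trans (s≤s z≤n) (proj₂ (proj₂ (∈-drop1⇒head< lowPoints-sorted t∈)))))
      below-at-0 : ∀ {a r} → Admissible a r → lineAt a r 0 ℚ.< ℓ 0
      below-at-0 {a} {r} adm = subst₂ ℚ._<_ (sym (lineAt-0 a r)) (sym (trans (lineAt-0 α ρ) ρ≡1)) (intercept<1 adm)
      above⇒1≤ : ∀ {a r} → Admissible a r → ∀ t → ℓ t ℚ.≤ lineAt a r t → 1 ≤ℕ t
      above⇒1≤ adm zero    ℓ≤ℓ′ = ⊥-elim (<⇒≱ (below-at-0 adm) ℓ≤ℓ′)
      above⇒1≤ adm (suc t) _    = s≤s z≤n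
      complete : ∀ {w} → Witness w → w ∈ innerUpWords
      complete u = [ (λ a≤α → ⊥-elim (¬Witness-below u a≤α (subst (r ℚ.<_) (sym ρ≡1) (intercept<1 admissible))))
                   , (λ α<a → [ id , (λ above → ⊥-elim (<⇒≱ (below-at-0 admissible) (above 0 z≤n (proj₁ (∈lowPoints⁻ 0∈low))))) ]′
                       (steep⇒∈innerUpWords⊎above-all u (ℚP.<⇒≤ α<a)
                         (λ t t≤n ℓ≤ℓ′ → up-admissible α<1 t t≤n (inj₁ 0<ρ) (inj₂ (above⇒1≤ admissible t ℓ≤ℓ′))))) ]′ (≤⊎> a α)
        where open Witness u

lemma3p2 : (n : ℕ) → 1 ℕ.≤ n → (α ρ : ℚ) →
    0ℚ ℚ.≤ α → α ℚ.≤ 1ℚ → 0ℚ ℚ.≤ ρ → ρ ℚ.≤ 1ℚ → 2 ℕ.≤ Zn n α ρ →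
      (α ≡ 1ℚ → ρ ≡ 1ℚ → HasSize (InM n α ρ) 0)
    × (α ≡ 0ℚ → ρ ≡ 0ℚ → HasSize (InM n α ρ) 1)
    × (0ℚ ℚ.< α → α ℚ.< 1ℚ → 0ℚ ℚ.< ρ → ρ ℚ.< 1ℚ →
        HasSize (InM n α ρ) (Zn n α ρ ∸ 1))
    × (ρ ≡ 0ℚ → 0ℚ ℚ.< α → α ℚ.≤ 1ℚ →
        HasSize (InM n α ρ) (Zn n α ρ ∸ Zhalf n α ρ))
    × (ρ ≡ 1ℚ → 0ℚ ℚ.≤ α → α ℚ.< 1ℚ →
        HasSize (InM n α ρ) (Zhalf n α ρ ∸ 1))
lemma3p2 n 1≤n α ρ 0≤α α≤1 0≤ρ ρ≤1 2≤Zn =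
    size-α≡1-ρ≡1
  , size-α≡0-ρ≡0
  , size-interior
  , (λ ρ≡0 0<α _ → size-ρ≡0 ρ≡0 0<α)
  , (λ ρ≡1 _ α<1 → size-ρ≡1 ρ≡1 α<1)
  where
  open Line n α ρ 0≤α α≤1 0≤ρ ρ≤1
  open Classification 1≤n 2≤Zn
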